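{- Let $k$ be a field of characteristic zero and let $V^\bullet=\bigoplus_{i\ge 1}V^i$ be a graded $k$-vector space with finite-dimensional components. Write the Poincar\'e series of the free graded commutative algebra generated by $V$ as $h(S^\bullet(V);t)=1+s_1t+s_2t^2+\cdots$ and put $\underline{s}=(s_1,s_2,\dots)$. Then for every integer $N\ge 1$, \[ \dim_k V^N=\frac{(-1)^{N+1}}{N}\sum_{d\mid N}\mu(N/d)\,p_d(\underline{s}), \] where the sum is over all positive divisors $d$ of $N$ and $\mu$ is the M\"obius function.
   Context: The Poincar\'e series of a graded vector space (or algebra) $W^\bullet$ with finite-dimensional components is $\sum_i\dim_k W^i t^i$. The free graded commutative algebra is $S^\bullet(V)=\bigotimes_{i\text{ even}}\mathrm{Sym}^\bullet(V^i)\otimes\bigotimes_{i\text{ odd}}\Lambda^\bullet(V^i)$, with elements of $V^i$ in degree $i$. For indeterminates $s_1,s_2,\dots$, $p_d(\underline{s})$ denotes the unique polynomial in $s_1,\dots,s_d$ such that whenever $s_i=\sigma_i(\gamma_1,\dots,\gamma_M)$ are the elementary symmetric polynomials in variables $\gamma_1,\dots,\gamma_M$ ($M\ge d$), one has $p_d(\underline{s})=\gamma_1^d+\cdots+\gamma_M^d$ (i.e. the $d$-th power sum (Newton polynomial) expressed through elementary symmetric polynomials; e.g. $p_1=s_1$, $p_2=s_1^2-2s_2$, $p_3=s_1^3-3s_1s_2+3s_3$). The M\"obius function is $\mu(n)=(-1)^k$ if $n$ is a product of $k$ distinct primes and $\mu(n)=0$ otherwise. -}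

module Defs where

open import Data.Nat as ℕ using (ℕ; zero; suc; _≤?_; _∸_)
open import Data.Nat.DivMod using (_/_)
open import Data.Nat.Divisibility using (_∣_; _∣?_)
open import Data.Nat.Primality using (Prime; prime?)
open import Data.Nat.Combinatorics using (_C_)

open import Data.Integer as ℤ using (ℤ; +_; -[1+_])
open import Data.List using (List; []; _∷_; map; filter; length; foldr; upTo)
open import Relation.Nullary using (yes; no)
open import Relation.Nullary.Decidable using (_×-dec_)

sgn : ℕ → ℤ
sgn m = -[1+ 0 ] ℤ.^ m

sumℤ : List ℤ → ℤ
sumℤ = foldr ℤ._+_ (+ 0)

sumℕ : List ℕ → ℕ
sumℕ = foldr ℕ._+_ 0

-- Möbius function, as in the paper: μ(n) = (-1)^k if n is a product of
-- k distinct primes, μ(n) = 0 otherwise.  (For n ≥ 1: n is a product of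
-- k distinct primes iff no prime square divides n and n has exactly k
-- prime divisors.)

-- the primes dividing n (for n ≥ 1 they all lie in 0..n)
primeDivisors : ℕ → List ℕ
primeDivisors n = filter (λ p → prime? p ×-dec (p ∣? n)) (upTo (suc n))

squaredPrimeDivisors : ℕ → List ℕ
squaredPrimeDivisors n = filter (λ p → (p ℕ.* p) ∣? n) (primeDivisors n)

μ : ℕ → ℤ
μ n with length (squaredPrimeDivisors n)
... | zero  = sgn (length (primeDivisors n))
... | suc _ = + 0

-- V is given by its dimension sequence v i = dim_k V^i (only i ≥ 1 is used,
-- since V = ⊕_{i≥1} V^i).  A power series is its coefficient function ℕ → ℕ.

-- dim Sym^j(k^m) = C(m+j-1, j) ;  dim Λ^j(k^m) = C(m, j)
symDim : ℕ → ℕ → ℕ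
symDim m j = (m ℕ.+ j ∸ 1) C j

extDim : ℕ → ℕ → ℕ
extDim m j = m C j

-- Poincaré series of the factor contributed by V^(suc k):
-- Sym^•(V^i) if i even, Λ^•(V^i) if i odd, generators placed in degree i.
factor : (ℕ → ℕ) → ℕ → (ℕ → ℕ)
factor v k n with suc k ∣? n | 2 ∣? suc k
... | yes _ | yes _ = symDim (v (suc k)) (n / suc k)
... | yes _ | no  _ = extDim (v (suc k)) (n / suc k)
... | no  _ | _     = 0

-- Cauchy product of power series (Poincaré series of a graded tensor product)
conv : (ℕ → ℕ) → (ℕ → ℕ) → (ℕ → ℕ)
conv f g n = sumℕ (map (λ i → f i ℕ.* g (n ∸ i)) (upTo (suc n)))

-- Poincaré series of ⊗_{1 ≤ i ≤ K} (Sym or Λ)(V^i)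
partialProduct : (ℕ → ℕ) → ℕ → (ℕ → ℕ)
partialProduct v zero    zero    = 1
partialProduct v zero    (suc _) = 0
partialProduct v (suc K) = conv (partialProduct v K) (factor v K)

-- s_n = dim_k S^n(V): only the generators of degree ≤ n contribute to degree n.
poincareS : (ℕ → ℕ) → ℕ → ℕ
poincareS v n = partialProduct v n n

-- Power-sum polynomials p_d(s) in the elementary symmetric polynomials,
-- determined by Newton's identities
--   p_d = (-1)^(d-1) d s_d + Σ_{i=1}^{d-1} (-1)^(d-1+i) s_(d-i) p_i .

-- next value p_(suc k) given p_1..p_k (in the function q)
newtonStep : (ℕ → ℤ) → (ℕ → ℤ) → ℕ → ℤ
newtonStep s q k =
  sgn k ℤ.* ((+ suc k) ℤ.* s (suc k))
  ℤ.+ sumℤ (map (λ i → sgn (k ℕ.+ suc i) ℤ.* (s (k ∸ i) ℤ.* q (suc i))) (upTo k))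

-- pTable s k d = p_d(s) for 1 ≤ d ≤ k
pTable : (ℕ → ℤ) → ℕ → (ℕ → ℤ)
pTable s zero    d = + 0
pTable s (suc k) d with d ≤? k
... | yes _ = pTable s k d
... | no  _ = newtonStep s (pTable s k) k

powerSum : (ℕ → ℤ) → ℕ → ℤ
powerSum s d = pTable s d d

-- positive divisors of N, each written as suc j
divisorsPred : ℕ → List ℕ
divisorsPred N = filter (λ j → suc j ∣? N) (upTo N)

-- Taking t d/dt log of the product formula
--   s(t) = Π_{i even} (1 - t^i)^(-dim V^i) · Π_{i odd} (1 + t^i)^(dim V^i)
-- gives t s'(t) = s(t) L(t) with L_n = Σ_{i ∣ n} (-1)^(n+i) i dim V^i; for a single factor
-- this is a binomial identity.  Newton's identities t s'(t) = s(t) Σ_d (-1)^(d-1) p_d t^d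
-- determine p_d(s) recursively (this recursion is powerSum), so comparing coefficients gives
-- p_d(s) = Σ_{i ∣ d} (-1)^(i+1) i dim V^i, and Möbius inversion isolates (-1)^(N+1) N dim V^N.

module Submission where

open import Defs
open import Data.Nat using (ℕ; zero; suc; _≤_; _<_; _≤′_; ≤′-refl; ≤′-step; z≤n; s≤s; _∸_; _≤?_; _≟_; NonZero; >-nonZero)
  renaming (_+_ to _+ᴺ_; _*_ to _*ᴺ_)
import Data.Nat.Properties as ℕ
import Data.Nat.Tactic.RingSolver as ℕ-Solver
open import Data.Nat.DivMod using (_/_; m*n/n≡m; m*n/o*n≡m/o)
open import Data.Nat.Divisibility
  using (_∣_; _∣?_; divides; ∣⇒≤; >⇒∤; ∣-trans; ∣-refl; m∣m*n; ∣m+n∣m⇒∣n; ∣m∸n∣n⇒∣m; *-cancelʳ-∣; *-monoˡ-∣; *-pres-∣)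
open import Data.Nat.Combinatorics using (_C_; nCk+nC[k+1]≡[n+1]C[k+1]; nC1≡n; k>n⇒nCk≡0)
open import Data.Nat.Primality using (Prime; prime?; euclidsLemma; prime⇒irreducible; prime⇒nonZero; ¬prime[0]; ¬prime[1])
open import Data.Nat.Primality.Factorisation using (factorise; PrimeFactorisation)
open import Data.Nat.ListAction using (product)
open import Data.Nat.Coprimality using (Coprime; coprime-divisor)
open import Data.Integer using (ℤ; +_; -_; _+_; _*_; -[1+_])
import Data.Integer.Properties as ℤ
open import Data.Integer.Tactic.RingSolver using (solve-∀)
open import Algebra.Bundles using (AbelianGroup)
open import Algebra.Properties.Group (AbelianGroup.group ℤ.+-0-abelianGroup) using (∙-cancelˡ)
open import Data.List using (List; []; _∷_; map; filter; length; upTo; applyUpTo)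
open import Data.List.Relation.Unary.All using (All; _∷_)
open import Data.List.Relation.Unary.Any using (here)
open import Data.List.Membership.Propositional using (_∈_)
open import Data.List.Membership.Propositional.Properties using (∈-filter⁺; ∈-filter⁻; ∈-upTo⁺; ∈-length)
open import Data.Empty using (⊥-elim)
open import Data.Product using (∃; _×_; _,_; proj₁; proj₂)
open import Data.Sum using (_⊎_; inj₁; inj₂; [_,_]′)
open import Function using (_∘_; id)
open import Relation.Nullary using (¬_; Dec; yes; no; ¬?)
open import Relation.Nullary.Decidable using (_×-dec_)
open import Relation.Binary.PropositionalEquality
  using (_≡_; _≢_; refl; sym; trans; cong; cong₂; subst; module ≡-Reasoning)
open ≡-Reasoning

∑ : ℕ → (ℕ → ℤ) → ℤ
∑ zero    f = + 0
∑ (suc n) f = f 0 + ∑ n (f ∘ suc)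

infixl 10 ∑
syntax ∑ n (λ i → e) = ∑[ i < n ] e

∑-cong : ∀ n {f g : ℕ → ℤ} → (∀ i → i < n → f i ≡ g i) → ∑ n f ≡ ∑ n g
∑-cong zero    eq = refl
∑-cong (suc n) eq = cong₂ _+_ (eq 0 (s≤s z≤n)) (∑-cong n (λ i i<n → eq (suc i) (s≤s i<n)))

∑-ext : ∀ n {f g : ℕ → ℤ} → (∀ i → f i ≡ g i) → ∑ n f ≡ ∑ n g
∑-ext n eq = ∑-cong n (λ i _ → eq i)

∑-replicate-zero : ∀ n → ∑[ i < n ] (+ 0) ≡ + 0
∑-replicate-zero zero    = refl
∑-replicate-zero (suc n) = trans (ℤ.+-identityˡ _) (∑-replicate-zero n)

∑-vanishing : ∀ n {f : ℕ → ℤ} → (∀ i → i < n → f i ≡ + 0) → ∑ n f ≡ + 0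
∑-vanishing n eq = trans (∑-cong n eq) (∑-replicate-zero n)

∑-distrib-+ : ∀ n (f g : ℕ → ℤ) → ∑[ i < n ] (f i + g i) ≡ ∑ n f + ∑ n g
∑-distrib-+ zero    f g = refl
∑-distrib-+ (suc n) f g = trans (cong (_+_ (f 0 + g 0)) (∑-distrib-+ n _ _)) (swap (f 0) (g 0) _ _)
  where
  swap : ∀ a b c d → (a + b) + (c + d) ≡ (a + c) + (b + d)
  swap = solve-∀

∑-*ˡ : ∀ n c (f : ℕ → ℤ) → ∑[ i < n ] (c * f i) ≡ c * ∑ n f
∑-*ˡ zero    c f = sym (ℤ.*-zeroʳ c)
∑-*ˡ (suc n) c f = trans (cong (_+_ (c * f 0)) (∑-*ˡ n c _)) (sym (ℤ.*-distribˡ-+ c (f 0) _))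

∑-*ʳ : ∀ n c (f : ℕ → ℤ) → ∑[ i < n ] (f i * c) ≡ ∑ n f * c
∑-*ʳ n c f = trans (∑-ext n (λ i → ℤ.*-comm (f i) c)) (trans (∑-*ˡ n c f) (ℤ.*-comm c _))

∑-neg : ∀ n (f : ℕ → ℤ) → ∑[ i < n ] (- f i) ≡ - ∑ n f
∑-neg zero    f = refl
∑-neg (suc n) f = trans (cong (_+_ (- f 0)) (∑-neg n _)) (sym (ℤ.neg-distrib-+ (f 0) _))

∑-split : ∀ m n (f : ℕ → ℤ) → ∑ (m +ᴺ n) f ≡ ∑ m f + ∑[ i < n ] f (m +ᴺ i)
∑-split zero    n f = sym (ℤ.+-identityˡ _)
∑-split (suc m) n f = trans (cong (_+_ (f 0)) (∑-split m n _)) (sym (ℤ.+-assoc (f 0) _ _))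

∑-last : ∀ n (f : ℕ → ℤ) → ∑ (suc n) f ≡ ∑ n f + f n
∑-last n f = begin
  ∑ (suc n) f                ≡⟨ cong (λ m → ∑ m f) (ℕ.+-comm 1 n) ⟩
  ∑ (n +ᴺ 1) f               ≡⟨ ∑-split n 1 f ⟩
  ∑ n f + (f (n +ᴺ 0) + + 0) ≡⟨ cong (_+_ (∑ n f)) (trans (ℤ.+-identityʳ _) (cong f (ℕ.+-identityʳ n))) ⟩
  ∑ n f + f n                ∎

∑-comm : ∀ m n (f : ℕ → ℕ → ℤ) → ∑[ i < m ] ∑[ j < n ] f i j ≡ ∑[ j < n ] ∑[ i < m ] f i j
∑-comm zero    n f = sym (∑-replicate-zero n)
∑-comm (suc m) n f = trans (cong (_+_ (∑ n (f 0))) (∑-comm m n _)) (sym (∑-distrib-+ n _ _))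

∑-reverse : ∀ n (f : ℕ → ℤ) → ∑ n f ≡ ∑[ i < n ] f (n ∸ suc i)
∑-reverse zero    f = refl
∑-reverse (suc n) f = trans (∑-last n f) (trans (cong (_+ f n) (∑-reverse n f)) (ℤ.+-comm _ (f n)))

∑-single : ∀ n {f : ℕ → ℤ} x → x < n → (∀ i → i < n → i ≢ x → f i ≡ + 0) → ∑ n f ≡ f x
∑-single (suc n) {f} zero _ others =
  trans (cong (_+_ (f 0)) (∑-vanishing n (λ i i<n → others (suc i) (s≤s i<n) (λ ())))) (ℤ.+-identityʳ (f 0))
∑-single (suc n) {f} (suc x) (s≤s x<n) others =
  trans (cong₂ _+_ (others 0 (s≤s z≤n) (λ ()))
                   (∑-single n x x<n (λ i i<n i≢x → others (suc i) (s≤s i<n) (i≢x ∘ ℕ.suc-injective))))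
        (ℤ.+-identityˡ _)

∑-truncate : ∀ n m {f : ℕ → ℤ} → n ≤ m → (∀ i → n ≤ i → i < m → f i ≡ + 0) → ∑ m f ≡ ∑ n f
∑-truncate n m {f} n≤m vanish = begin
  ∑ m f                                ≡⟨ cong (λ k → ∑ k f) (sym (ℕ.m+[n∸m]≡n n≤m)) ⟩
  ∑ (n +ᴺ (m ∸ n)) f                   ≡⟨ ∑-split n (m ∸ n) f ⟩
  ∑ n f + ∑[ i < m ∸ n ] f (n +ᴺ i)    ≡⟨ cong (_+_ (∑ n f)) (∑-vanishing (m ∸ n) tail) ⟩
  ∑ n f + + 0                          ≡⟨ ℤ.+-identityʳ _ ⟩
  ∑ n f                                ∎
  where
  tail : ∀ i → i < m ∸ n → f (n +ᴺ i) ≡ + 0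
  tail i i<m∸n = vanish (n +ᴺ i) (ℕ.m≤m+n n i)
    (subst (n +ᴺ i <_) (ℕ.m+[n∸m]≡n n≤m) (ℕ.+-monoʳ-< n i<m∸n))

∑-multiples : ∀ i j (g : ℕ → ℤ) → (∀ a → ¬ (suc i ∣ a) → g a ≡ + 0) →
  ∑ (suc (j *ᴺ suc i)) g ≡ ∑[ a < suc j ] g (a *ᴺ suc i)
∑-multiples i zero    g vanish = refl
∑-multiples i (suc j) g vanish = begin
  ∑ (suc (suc j *ᴺ suc i)) g
    ≡⟨ cong (λ m → ∑ (suc m) g) (ℕ.+-comm (suc i) (j *ᴺ suc i)) ⟩
  ∑ (suc (j *ᴺ suc i) +ᴺ suc i) g
    ≡⟨ ∑-split (suc (j *ᴺ suc i)) (suc i) g ⟩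
  ∑ (suc (j *ᴺ suc i)) g + ∑[ c < suc i ] g (suc (j *ᴺ suc i) +ᴺ c)
    ≡⟨ cong₂ _+_ (∑-multiples i j g vanish) (∑-single (suc i) i ℕ.≤-refl gap) ⟩
  ∑[ a < suc j ] g (a *ᴺ suc i) + g (suc (j *ᴺ suc i) +ᴺ i)
    ≡⟨ cong (λ m → ∑[ a < suc j ] g (a *ᴺ suc i) + g m) (trans (sym (ℕ.+-suc (j *ᴺ suc i) i)) (ℕ.+-comm (j *ᴺ suc i) (suc i))) ⟩
  ∑[ a < suc j ] g (a *ᴺ suc i) + g (suc j *ᴺ suc i)
    ≡⟨ sym (∑-last (suc j) (λ a → g (a *ᴺ suc i))) ⟩
  ∑[ a < suc (suc j) ] g (a *ᴺ suc i) ∎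
  where
  gap : ∀ c → c < suc i → c ≢ i → g (suc (j *ᴺ suc i) +ᴺ c) ≡ + 0
  gap c c≤i c≢i = vanish _ (>⇒∤ (s≤s c<i) ∘ cancel)
    where
    c<i : c < i
    c<i = ℕ.≤∧≢⇒< (ℕ.≤-pred c≤i) c≢i
    cancel : suc i ∣ suc (j *ᴺ suc i) +ᴺ c → suc i ∣ suc c
    cancel i+1∣ = ∣m+n∣m⇒∣n (subst (suc i ∣_) (sym (ℕ.+-suc (j *ᴺ suc i) c)) i+1∣) (divides j refl)

∑-positive-multiples : ∀ i j (g : ℕ → ℤ) → (∀ a → ¬ (suc i ∣ a) → g a ≡ + 0) →
  ∑[ a < j *ᴺ suc i ] g (suc a) ≡ ∑[ c < j ] g (suc c *ᴺ suc i)
∑-positive-multiples i j g vanish = ∙-cancelˡ (g 0) _ _ (∑-multiples i j g vanish)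

when : ∀ {p} {P : Set p} → Dec P → ℤ → ℤ
when (yes _) x = x
when (no _)  _ = + 0

module _ {p} {P : Set p} where

  when-yes : (P? : Dec P) (x : ℤ) → P → when P? x ≡ x
  when-yes (yes _) x _  = refl
  when-yes (no ¬p) x p = ⊥-elim (¬p p)

  when-no : (P? : Dec P) (x : ℤ) → ¬ P → when P? x ≡ + 0
  when-no (yes p) x ¬p = ⊥-elim (¬p p)
  when-no (no _)  x _  = refl

  when-0 : (P? : Dec P) → when P? (+ 0) ≡ + 0
  when-0 (yes _) = refl
  when-0 (no _)  = refl

  when-∑ : (P? : Dec P) (n : ℕ) (f : ℕ → ℤ) → when P? (∑ n f) ≡ ∑[ i < n ] when P? (f i)
  when-∑ (yes _) n f = refl
  when-∑ (no _)  n f = sym (∑-replicate-zero n)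

  when-*ʳ : (P? : Dec P) (x y : ℤ) → when P? (x * y) ≡ when P? x * y
  when-*ʳ (yes _) x y = refl
  when-*ʳ (no _)  x y = refl

  *-when : (c : ℤ) (P? : Dec P) (x : ℤ) → c * when P? x ≡ when P? (c * x)
  *-when c (yes _) x = refl
  *-when c (no _)  x = ℤ.*-zeroʳ c

  when-neg : (P? : Dec P) (x : ℤ) → when P? (- x) ≡ - when P? x
  when-neg (yes _) x = refl
  when-neg (no _)  x = refl

  when-+ : (P? : Dec P) (x y : ℤ) → when P? (x + y) ≡ when P? x + when P? y
  when-+ (yes _) x y = refl
  when-+ (no _)  x y = refl

  when-split : (P? : Dec P) (x : ℤ) → x ≡ when P? x + when (¬? P?) x
  when-split (yes _) x = sym (ℤ.+-identityʳ x)
  when-split (no _)  x = sym (ℤ.+-identityˡ x)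

when-cong : ∀ {p q} {P : Set p} {Q : Set q} (P? : Dec P) (Q? : Dec Q) {x y : ℤ} →
  (P → Q) → (Q → P) → (P → x ≡ y) → when P? x ≡ when Q? y
when-cong (yes p) (yes q) _ _ eq = eq p
when-cong (yes p) (no ¬q) f _ _  = ⊥-elim (¬q (f p))
when-cong (no ¬p) (yes q) _ g _  = ⊥-elim (¬p (g q))
when-cong (no _)  (no _)  _ _ _  = refl

sumℤ-applyUpTo : ∀ (f : ℕ → ℤ) (g : ℕ → ℕ) n → sumℤ (map f (applyUpTo g n)) ≡ ∑[ i < n ] f (g i)
sumℤ-applyUpTo f g zero    = refl
sumℤ-applyUpTo f g (suc n) = cong (_+_ (f (g 0))) (sumℤ-applyUpTo f (g ∘ suc) n)

sumℤ-upTo : ∀ (f : ℕ → ℤ) n → sumℤ (map f (upTo n)) ≡ ∑ n f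
sumℤ-upTo f = sumℤ-applyUpTo f id

sumℕ-applyUpTo : ∀ (f : ℕ → ℕ) (g : ℕ → ℕ) n → + sumℕ (map f (applyUpTo g n)) ≡ ∑[ i < n ] (+ f (g i))
sumℕ-applyUpTo f g zero    = refl
sumℕ-applyUpTo f g (suc n) = trans (ℤ.pos-+ (f (g 0)) _) (cong (_+_ (+ f (g 0))) (sumℕ-applyUpTo f (g ∘ suc) n))

sumℤ-filter : ∀ {P : ℕ → Set} (P? : ∀ x → Dec (P x)) (h : ℕ → ℤ) (l : List ℕ) →
  sumℤ (map h (filter P? l)) ≡ sumℤ (map (λ x → when (P? x) (h x)) l)
sumℤ-filter P? h []       = refl
sumℤ-filter P? h (x ∷ xs) with P? x
... | yes _ = cong (_+_ (h x)) (sumℤ-filter P? h xs)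
... | no _  = trans (sumℤ-filter P? h xs) (sym (ℤ.+-identityˡ _))

divisorSum : (ℕ → ℤ) → ℕ → ℤ
divisorSum f n = ∑[ j < n ] when (suc j ∣? n) (f (suc j))

sumℤ-divisorsPred : ∀ N (f : ℕ → ℤ) → sumℤ (map f (divisorsPred N)) ≡ ∑[ j < N ] when (suc j ∣? N) (f j)
sumℤ-divisorsPred N f = trans (sumℤ-filter (λ j → suc j ∣? N) f (upTo N)) (sumℤ-upTo (λ j → when (suc j ∣? N) (f j)) N)

sgn-suc : ∀ m → sgn (suc m) ≡ - sgn m
sgn-suc m = ℤ.-1*i≡-i (sgn m)

sgn-+ : ∀ m n → sgn (m +ᴺ n) ≡ sgn m * sgn n
sgn-+ = ℤ.^-distribˡ-+-* -[1+ 0 ]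

sgn-suc-suc : ∀ m → sgn (suc (suc m)) ≡ sgn m
sgn-suc-suc m = trans (sgn-suc (suc m)) (trans (cong -_ (sgn-suc m)) (ℤ.neg-involutive _))

sgn-*2 : ∀ m → sgn (m *ᴺ 2) ≡ + 1
sgn-*2 zero    = refl
sgn-*2 (suc m) = trans (sgn-suc-suc (m *ᴺ 2)) (sgn-*2 m)

sgn*sgn≡1 : ∀ m → sgn m * sgn m ≡ + 1
sgn*sgn≡1 m = trans (sym (sgn-+ m m)) (trans (cong sgn m+m≡m*2) (sgn-*2 m))
  where
  m+m≡m*2 : m +ᴺ m ≡ m *ᴺ 2
  m+m≡m*2 = trans (cong (m +ᴺ_) (sym (ℕ.*-identityʳ m))) (sym (ℕ.*-suc m 1))

sgn-cancelˡ : ∀ m x → x ≡ sgn m * (sgn m * x)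
sgn-cancelˡ m x = begin
  x                   ≡⟨ ℤ.*-identityˡ x ⟨
  + 1 * x             ≡⟨ cong (_* x) (sgn*sgn≡1 m) ⟨
  sgn m * sgn m * x   ≡⟨ ℤ.*-assoc (sgn m) (sgn m) x ⟩
  sgn m * (sgn m * x) ∎

parity : ∀ n → ∃ (λ c → n ≡ c *ᴺ 2) ⊎ ∃ (λ c → n ≡ suc (c *ᴺ 2))
parity zero = inj₁ (0 , refl)
parity (suc n) with parity n
... | inj₁ (c , n≡2c)   = inj₂ (c , cong suc n≡2c)
... | inj₂ (c , n≡2c+1) = inj₁ (suc c , cong suc n≡2c+1)

sgn-*-even : ∀ b i → 2 ∣ i → sgn (b *ᴺ i) ≡ + 1
sgn-*-even b _ (divides q refl) = trans (cong sgn (sym (ℕ.*-assoc b q 2))) (sgn-*2 (b *ᴺ q))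

sgn-*-odd : ∀ b i → ¬ 2 ∣ i → sgn (b *ᴺ i) ≡ sgn b
sgn-*-odd b i 2∤i with parity i
... | inj₁ (c , i≡2c) = ⊥-elim (2∤i (divides c i≡2c))
... | inj₂ (c , refl) = begin
  sgn (b *ᴺ suc (c *ᴺ 2))        ≡⟨ cong sgn (ℕ.*-suc b (c *ᴺ 2)) ⟩
  sgn (b +ᴺ b *ᴺ (c *ᴺ 2))       ≡⟨ sgn-+ b _ ⟩
  sgn b * sgn (b *ᴺ (c *ᴺ 2))    ≡⟨ cong (λ m → sgn b * sgn m) (sym (ℕ.*-assoc b c 2)) ⟩
  sgn b * sgn (b *ᴺ c *ᴺ 2)      ≡⟨ cong (sgn b *_) (sgn-*2 (b *ᴺ c)) ⟩
  sgn b * + 1                    ≡⟨ ℤ.*-identityʳ _ ⟩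
  sgn b                          ∎

-- Power series

infixl 7 _⋆_

_⋆_ : (ℕ → ℤ) → (ℕ → ℤ) → ℕ → ℤ
(f ⋆ g) n = ∑[ a < suc n ] (f a * g (n ∸ a))

⋆-cong : ∀ {f f′ g g′ : ℕ → ℤ} n → (∀ a → a ≤ n → f a ≡ f′ a) → (∀ a → a ≤ n → g a ≡ g′ a) →
  (f ⋆ g) n ≡ (f′ ⋆ g′) n
⋆-cong n eqᶠ eqᵍ = ∑-cong (suc n) λ a a≤n → cong₂ _*_ (eqᶠ a (ℕ.≤-pred a≤n)) (eqᵍ (n ∸ a) (ℕ.m∸n≤m n a))

⋆-comm : ∀ (f g : ℕ → ℤ) n → (f ⋆ g) n ≡ (g ⋆ f) n
⋆-comm f g n = trans (∑-reverse (suc n) (λ a → f a * g (n ∸ a))) (∑-cong (suc n) reflect)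
  where
  reflect : ∀ a → a < suc n → f (n ∸ a) * g (n ∸ (n ∸ a)) ≡ g a * f (n ∸ a)
  reflect a a≤n = trans (cong (λ b → f (n ∸ a) * g b) (ℕ.m∸[m∸n]≡n (ℕ.≤-pred a≤n))) (ℤ.*-comm (f (n ∸ a)) (g a))

⋆-distribˡ-+ : ∀ (f g h : ℕ → ℤ) n → (f ⋆ (λ c → g c + h c)) n ≡ (f ⋆ g) n + (f ⋆ h) n
⋆-distribˡ-+ f g h n = trans (∑-ext (suc n) λ a → ℤ.*-distribˡ-+ (f a) (g (n ∸ a)) (h (n ∸ a)))
  (∑-distrib-+ (suc n) (λ a → f a * g (n ∸ a)) (λ a → f a * h (n ∸ a)))

∑-triangle : ∀ n (F : ℕ → ℕ → ℤ) →
  ∑[ a < suc n ] ∑[ b < suc a ] F a b ≡ ∑[ b < suc n ] ∑[ c < suc (n ∸ b) ] F (b +ᴺ c) b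
∑-triangle n F = begin
  ∑[ a < suc n ] ∑[ b < suc a ] F a b   ≡⟨ ∑-cong (suc n) row ⟩
  ∑[ a < suc n ] ∑[ b < suc n ] E a b   ≡⟨ ∑-comm (suc n) (suc n) E ⟩
  ∑[ b < suc n ] ∑[ a < suc n ] E a b   ≡⟨ ∑-cong (suc n) (λ b b≤n → column b (ℕ.≤-pred b≤n)) ⟩
  ∑[ b < suc n ] ∑[ c < suc (n ∸ b) ] F (b +ᴺ c) b ∎
  where
  E : ℕ → ℕ → ℤ
  E a b = when (b ≤? a) (F a b)
  below : ∀ a b → ¬ b ≤ a → E a b ≡ + 0
  below a b = when-no (b ≤? a) (F a b)
  row : ∀ a → a < suc n → ∑[ b < suc a ] F a b ≡ ∑[ b < suc n ] E a b
  row a a≤n = begin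
    ∑[ b < suc a ] F a b ≡⟨ ∑-cong (suc a) (λ b b≤a → sym (when-yes (b ≤? a) (F a b) (ℕ.≤-pred b≤a))) ⟩
    ∑[ b < suc a ] E a b ≡⟨ ∑-truncate (suc a) (suc n) a≤n (λ b a<b _ → below a b (ℕ.<⇒≱ a<b)) ⟨
    ∑[ b < suc n ] E a b ∎
  column : ∀ b → b ≤ n → ∑[ a < suc n ] E a b ≡ ∑[ c < suc (n ∸ b) ] F (b +ᴺ c) b
  column b b≤n = begin
    ∑[ a < suc n ] E a b
      ≡⟨ cong (λ m → ∑[ a < m ] E a b) (sym (ℕ.m+[n∸m]≡n (ℕ.m≤n⇒m≤1+n b≤n))) ⟩
    ∑[ a < b +ᴺ (suc n ∸ b) ] E a b
      ≡⟨ ∑-split b (suc n ∸ b) (λ a → E a b) ⟩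
    ∑[ a < b ] E a b + ∑[ c < suc n ∸ b ] E (b +ᴺ c) b
      ≡⟨ cong₂ _+_ (∑-vanishing b (λ a a<b → below a b (ℕ.<⇒≱ a<b))) (cong (λ m → ∑[ c < m ] E (b +ᴺ c) b) (ℕ.+-∸-assoc 1 b≤n)) ⟩
    + 0 + ∑[ c < suc (n ∸ b) ] E (b +ᴺ c) b
      ≡⟨ ℤ.+-identityˡ _ ⟩
    ∑[ c < suc (n ∸ b) ] E (b +ᴺ c) b
      ≡⟨ ∑-ext (suc (n ∸ b)) (λ c → when-yes (b ≤? b +ᴺ c) (F (b +ᴺ c) b) (ℕ.m≤m+n b c)) ⟩
    ∑[ c < suc (n ∸ b) ] F (b +ᴺ c) b ∎

⋆-assoc : ∀ (f g h : ℕ → ℤ) n → ((f ⋆ g) ⋆ h) n ≡ (f ⋆ (g ⋆ h)) n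
⋆-assoc f g h n = begin
  ∑[ a < suc n ] ((f ⋆ g) a * h (n ∸ a))
    ≡⟨ ∑-ext (suc n) (λ a → sym (∑-*ʳ (suc a) (h (n ∸ a)) (λ b → f b * g (a ∸ b)))) ⟩
  ∑[ a < suc n ] ∑[ b < suc a ] (f b * g (a ∸ b) * h (n ∸ a))
    ≡⟨ ∑-triangle n (λ a b → f b * g (a ∸ b) * h (n ∸ a)) ⟩
  ∑[ b < suc n ] ∑[ c < suc (n ∸ b) ] (f b * g (b +ᴺ c ∸ b) * h (n ∸ (b +ᴺ c)))
    ≡⟨ ∑-ext (suc n) (λ b → ∑-ext (suc (n ∸ b)) (λ c → reassociate b c)) ⟩
  ∑[ b < suc n ] ∑[ c < suc (n ∸ b) ] (f b * (g c * h (n ∸ b ∸ c)))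
    ≡⟨ ∑-ext (suc n) (λ b → ∑-*ˡ (suc (n ∸ b)) (f b) (λ c → g c * h (n ∸ b ∸ c))) ⟩
  ∑[ b < suc n ] (f b * (g ⋆ h) (n ∸ b)) ∎
  where
  reassociate : ∀ b c → f b * g (b +ᴺ c ∸ b) * h (n ∸ (b +ᴺ c)) ≡ f b * (g c * h (n ∸ b ∸ c))
  reassociate b c = trans (cong₂ (λ x y → f b * g x * h y) (ℕ.m+n∸m≡n b c) (sym (ℕ.∸-+-assoc n b c)))
                          (ℤ.*-assoc (f b) (g c) _)

-- The Euler operator t d/dt on coefficient sequences.
δ : (ℕ → ℤ) → ℕ → ℤ
δ f a = + a * f a

δ-⋆ : ∀ (f g : ℕ → ℤ) n → δ (f ⋆ g) n ≡ (δ f ⋆ g) n + (f ⋆ δ g) n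
δ-⋆ f g n = begin
  + n * (f ⋆ g) n
    ≡⟨ sym (∑-*ˡ (suc n) (+ n) (λ a → f a * g (n ∸ a))) ⟩
  ∑[ a < suc n ] (+ n * (f a * g (n ∸ a)))
    ≡⟨ ∑-cong (suc n) (λ a a≤n → trans (cong (λ m → + m * (f a * g (n ∸ a))) (sym (ℕ.m+[n∸m]≡n (ℕ.≤-pred a≤n))))
                                        (leibniz (+ a) (+ (n ∸ a)) (f a) (g (n ∸ a)))) ⟩
  ∑[ a < suc n ] (δ f a * g (n ∸ a) + f a * δ g (n ∸ a))
    ≡⟨ ∑-distrib-+ (suc n) (λ a → δ f a * g (n ∸ a)) (λ a → f a * δ g (n ∸ a)) ⟩
  (δ f ⋆ g) n + (f ⋆ δ g) n ∎
  where
  leibniz : ∀ a b x y → (a + b) * (x * y) ≡ a * x * y + x * (b * y)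
  leibniz = solve-∀

conv≡⋆ : ∀ (f g : ℕ → ℕ) n → + conv f g n ≡ ((λ a → + f a) ⋆ (λ a → + g a)) n
conv≡⋆ f g n = trans (sumℕ-applyUpTo (λ a → f a *ᴺ g (n ∸ a)) (λ a → a) (suc n))
                     (∑-ext (suc n) (λ a → ℤ.pos-* (f a) (g (n ∸ a))))

-- Newton's identities in generating-function form: t s'(t) = s(t) Σ_d (-1)^(d-1) p_d t^d.
NewtonIdentity : (s p : ℕ → ℤ) → ℕ → Set
NewtonIdentity s p n = δ s (suc n) ≡ ∑[ a < suc n ] (sgn a * p (suc a) * s (n ∸ a))

module _ (s p : ℕ → ℤ) (s₀≡1 : s 0 ≡ + 1) where

  newtonStep-solves : ∀ k → NewtonIdentity s p k → newtonStep s p k ≡ p (suc k)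
  newtonStep-solves k newton = begin
    newtonStep s p k
      ≡⟨ cong (_+_ (σ * δ s (suc k))) (sumℤ-upTo (λ i → sgn (k +ᴺ suc i) * (s (k ∸ i) * p (suc i))) k) ⟩
    σ * δ s (suc k) + ∑[ i < k ] (sgn (k +ᴺ suc i) * (s (k ∸ i) * p (suc i)))
      ≡⟨ cong₂ _+_ (cong (σ *_) (trans newton (∑-last k _))) (trans (∑-ext k term) (∑-neg k _)) ⟩
    σ * (Σ′ + sgn k * p (suc k) * s (k ∸ k)) + - ∑[ i < k ] (σ * (sgn i * p (suc i) * s (k ∸ i)))
      ≡⟨ cong₂ (λ x y → σ * (Σ′ + sgn k * p (suc k) * x) + - y) (trans (cong s (ℕ.n∸n≡0 k)) s₀≡1) (∑-*ˡ k σ _) ⟩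
    σ * (Σ′ + σ * p (suc k) * + 1) + - (σ * Σ′)
      ≡⟨ cancel σ Σ′ (p (suc k)) ⟩
    σ * σ * p (suc k)
      ≡⟨ cong (_* p (suc k)) (sgn*sgn≡1 k) ⟩
    + 1 * p (suc k)
      ≡⟨ ℤ.*-identityˡ _ ⟩
    p (suc k) ∎
    where
    σ = sgn k
    Σ′ = ∑[ a < k ] (sgn a * p (suc a) * s (k ∸ a))
    term : ∀ i → sgn (k +ᴺ suc i) * (s (k ∸ i) * p (suc i)) ≡ - (σ * (sgn i * p (suc i) * s (k ∸ i)))
    term i = begin
      sgn (k +ᴺ suc i) * (s (k ∸ i) * p (suc i))
        ≡⟨ cong (λ n → sgn n * (s (k ∸ i) * p (suc i))) (ℕ.+-suc k i) ⟩
      sgn (suc (k +ᴺ i)) * (s (k ∸ i) * p (suc i))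
        ≡⟨ cong (_* (s (k ∸ i) * p (suc i))) (trans (sgn-suc (k +ᴺ i)) (cong -_ (sgn-+ k i))) ⟩
      - (σ * sgn i) * (s (k ∸ i) * p (suc i))
        ≡⟨ rearrange σ (sgn i) (s (k ∸ i)) (p (suc i)) ⟩
      - (σ * (sgn i * p (suc i) * s (k ∸ i))) ∎
      where
      rearrange : ∀ x y a b → - (x * y) * (a * b) ≡ - (x * (y * b * a))
      rearrange = solve-∀
    cancel : ∀ x S q → x * (S + x * q * + 1) + - (x * S) ≡ x * x * q
    cancel = solve-∀

  newtonStep-cong : ∀ (q q′ : ℕ → ℤ) k → (∀ d → d < k → q (suc d) ≡ q′ (suc d)) → newtonStep s q k ≡ newtonStep s q′ k
  newtonStep-cong q q′ k eq = cong (_+_ (sgn k * δ s (suc k))) (begin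
    sumℤ (map (term q) (upTo k))   ≡⟨ sumℤ-upTo (term q) k ⟩
    ∑ k (term q)                   ≡⟨ ∑-cong k (λ i i<k → cong (λ x → sgn (k +ᴺ suc i) * (s (k ∸ i) * x)) (eq i i<k)) ⟩
    ∑ k (term q′)                  ≡⟨ sumℤ-upTo (term q′) k ⟨
    sumℤ (map (term q′) (upTo k))  ∎)
    where
    term : (ℕ → ℤ) → ℕ → ℤ
    term q i = sgn (k +ᴺ suc i) * (s (k ∸ i) * q (suc i))

  module _ (N : ℕ) (newton : ∀ n → n < N → NewtonIdentity s p n) where

    pTable-newton : ∀ k → k ≤ N → ∀ d → 1 ≤ d → d ≤ k → pTable s k d ≡ p d
    pTable-newton zero    _   (suc _) _ ()
    pTable-newton (suc k) k<N d 1≤d d≤k+1 with d ≤? k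
    ... | yes d≤k = pTable-newton k (ℕ.<⇒≤ k<N) d 1≤d d≤k
    ... | no d≰k  = begin
      newtonStep s (pTable s k) k
        ≡⟨ newtonStep-cong (pTable s k) p k (λ d d<k → pTable-newton k (ℕ.<⇒≤ k<N) (suc d) (s≤s z≤n) d<k) ⟩
      newtonStep s p k ≡⟨ newtonStep-solves k (newton k k<N) ⟩
      p (suc k)        ≡⟨ cong p (ℕ.≤-antisym (ℕ.≰⇒> d≰k) d≤k+1) ⟩
      p d              ∎

  powerSum-newton : ∀ d → 1 ≤ d → (∀ n → n < d → NewtonIdentity s p n) → powerSum s d ≡ p d
  powerSum-newton d 1≤d newton = pTable-newton d newton d ℕ.≤-refl d 1≤d ℕ.≤-refl

∈-primeDivisors⁺ : ∀ {q n} → Prime q → q ∣ n → q < suc n → q ∈ primeDivisors n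
∈-primeDivisors⁺ {q} {n} q-prime q∣n q<1+n = ∈-filter⁺ (λ p → prime? p ×-dec p ∣? n) (∈-upTo⁺ q<1+n) (q-prime , q∣n)

∈-primeDivisors⁻ : ∀ {q} n → q ∈ primeDivisors n → Prime q × q ∣ n
∈-primeDivisors⁻ {q} n q∈ = proj₂ (∈-filter⁻ (λ p → prime? p ×-dec p ∣? n) {xs = upTo (suc n)} q∈)

∈-squaredPrimeDivisors⁺ : ∀ {q n} → q ∈ primeDivisors n → q *ᴺ q ∣ n → q ∈ squaredPrimeDivisors n
∈-squaredPrimeDivisors⁺ {q} {n} = ∈-filter⁺ (λ p → p *ᴺ p ∣? n)

∈-squaredPrimeDivisors⁻ : ∀ {q} n → q ∈ squaredPrimeDivisors n → q ∈ primeDivisors n × q *ᴺ q ∣ n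
∈-squaredPrimeDivisors⁻ {q} n = ∈-filter⁻ (λ p → p *ᴺ p ∣? n) {xs = primeDivisors n}

squaredPrimeDivisor : ∀ {q} n .{{_ : NonZero n}} → Prime q → q *ᴺ q ∣ n → q ∈ squaredPrimeDivisors n
squaredPrimeDivisor n q-prime qq∣n =
  ∈-squaredPrimeDivisors⁺ (∈-primeDivisors⁺ q-prime q∣n (s≤s (∣⇒≤ q∣n))) qq∣n
  where
  q∣n = ∣-trans (m∣m*n _) qq∣n

μ-squarefree : ∀ n → length (squaredPrimeDivisors n) ≡ 0 → μ n ≡ sgn (length (primeDivisors n))
μ-squarefree n len≡0 with length (squaredPrimeDivisors n)
... | zero = refl

μ-nonsquarefree : ∀ {q} n → q ∈ squaredPrimeDivisors n → μ n ≡ + 0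
μ-nonsquarefree n q∈ with length (squaredPrimeDivisors n) | ∈-length q∈
... | suc _ | _ = refl

emptyOrMember : (xs : List ℕ) → length xs ≡ 0 ⊎ ∃ (_∈ xs)
emptyOrMember []      = inj₁ refl
emptyOrMember (x ∷ _) = inj₂ (x , here refl)

+length-filter : ∀ {P : ℕ → Set} (P? : ∀ x → Dec (P x)) (l : List ℕ) →
  + length (filter P? l) ≡ sumℤ (map (λ x → when (P? x) (+ 1)) l)
+length-filter P? []       = refl
+length-filter P? (x ∷ xs) with P? x
... | yes _ = cong (_+_ (+ 1)) (+length-filter P? xs)
... | no _  = trans (+length-filter P? xs) (sym (ℤ.+-identityˡ _))

+length-primeDivisors : ∀ n → + length (primeDivisors n) ≡ ∑[ q < suc n ] when (prime? q ×-dec q ∣? n) (+ 1)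
+length-primeDivisors n = trans (+length-filter (λ q → prime? q ×-dec q ∣? n) (upTo (suc n)))
                                (sumℤ-upTo (λ q → when (prime? q ×-dec q ∣? n) (+ 1)) (suc n))

prime∣prime⇒≡ : ∀ {p q} → Prime p → Prime q → q ∣ p → q ≡ p
prime∣prime⇒≡ p-prime q-prime q∣p with prime⇒irreducible p-prime q∣p
... | inj₁ refl = ⊥-elim (¬prime[1] q-prime)
... | inj₂ q≡p  = q≡p

prime∤⇒coprime : ∀ {p e} → Prime p → ¬ p ∣ e → Coprime e p
prime∤⇒coprime p-prime p∤e (d∣e , d∣p) with prime⇒irreducible p-prime d∣p
... | inj₁ d≡1 = d≡1
... | inj₂ refl = ⊥-elim (p∤e d∣e)

module _ {p} (p-prime : Prime p) (c : ℕ) where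

  private
    instance
      p≢0 : NonZero p
      p≢0 = prime⇒nonZero p-prime
      n≢0 : NonZero (suc c *ᴺ p)
      n≢0 = ℕ.m*n≢0 (suc c) p
    n = suc c *ᴺ p

  μ-*-prime-∣ : p ∣ suc c → μ n ≡ + 0
  μ-*-prime-∣ p∣c = μ-nonsquarefree n (squaredPrimeDivisor n p-prime (*-pres-∣ p∣c ∣-refl))

  module _ (p∤c : ¬ p ∣ suc c) where

    ∈-squaredPrimeDivisors-*⁺ : ∀ {x} → x ∈ squaredPrimeDivisors (suc c) → x ∈ squaredPrimeDivisors n
    ∈-squaredPrimeDivisors-*⁺ x∈ with ∈-squaredPrimeDivisors⁻ (suc c) x∈
    ... | x∈pd , xx∣c = squaredPrimeDivisor n (proj₁ (∈-primeDivisors⁻ (suc c) x∈pd)) (∣-trans xx∣c (m∣m*n p))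

    ∈-squaredPrimeDivisors-*⁻ : ∀ {x} → x ∈ squaredPrimeDivisors n → x ∈ squaredPrimeDivisors (suc c)
    ∈-squaredPrimeDivisors-*⁻ {x} x∈ with ∈-squaredPrimeDivisors⁻ n x∈
    ... | x∈pd , xx∣n with ∈-primeDivisors⁻ n x∈pd
    ... | x-prime , _ = squaredPrimeDivisor (suc c) x-prime (coprime-divisor (prime∤⇒coprime p-prime p∤xx) xx∣p*c)
      where
      xx∣p*c : x *ᴺ x ∣ p *ᴺ suc c
      xx∣p*c = subst (x *ᴺ x ∣_) (ℕ.*-comm (suc c) p) xx∣n
      p∤xx : ¬ p ∣ x *ᴺ x
      p∤xx p∣xx = p∤c (*-cancelʳ-∣ p (subst (λ y → y *ᴺ y ∣ n) (sym (prime∣prime⇒≡ x-prime p-prime p∣x)) xx∣n))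
        where
        p∣x = [ id , id ]′ (euclidsLemma x x p-prime p∣xx)

    private
      primeDivisor-indicator : ∀ {q} (q-prime? : Dec (Prime q)) (q∣n? : Dec (q ∣ n)) (q∣c? : Dec (q ∣ suc c)) (q≟p : Dec (q ≡ p)) →
        when (q-prime? ×-dec q∣n?) (+ 1) ≡ when (q-prime? ×-dec q∣c?) (+ 1) + when q≟p (+ 1)
      primeDivisor-indicator (no q-composite) _ _ (yes refl) = ⊥-elim (q-composite p-prime)
      primeDivisor-indicator (no _) _ _ (no _) = refl
      primeDivisor-indicator (yes _) (yes _) (yes p∣c) (yes refl) = ⊥-elim (p∤c p∣c)
      primeDivisor-indicator (yes _) (yes _) (yes _) (no _) = refl
      primeDivisor-indicator (yes _) (yes _) (no _) (yes _) = refl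
      primeDivisor-indicator (yes q-prime) (yes q∣n) (no q∤c) (no q≢p) with euclidsLemma (suc c) p q-prime q∣n
      ... | inj₁ q∣c = ⊥-elim (q∤c q∣c)
      ... | inj₂ q∣p = ⊥-elim (q≢p (prime∣prime⇒≡ p-prime q-prime q∣p))
      primeDivisor-indicator (yes _) (no q∤n) (yes q∣c) _ = ⊥-elim (q∤n (∣-trans q∣c (m∣m*n p)))
      primeDivisor-indicator (yes _) (no q∤n) (no _) (yes refl) = ⊥-elim (q∤n (divides (suc c) refl))
      primeDivisor-indicator (yes _) (no _) (no _) (no _) = refl

    length-primeDivisors-* : length (primeDivisors n) ≡ suc (length (primeDivisors (suc c)))
    length-primeDivisors-* = ℤ.+-injective (begin
      + length (primeDivisors n)
        ≡⟨ +length-primeDivisors n ⟩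
      ∑[ q < suc n ] when (prime? q ×-dec q ∣? n) (+ 1)
        ≡⟨ ∑-ext (suc n) (λ q → primeDivisor-indicator (prime? q) (q ∣? n) (q ∣? suc c) (q ≟ p)) ⟩
      ∑[ q < suc n ] (when (prime? q ×-dec q ∣? suc c) (+ 1) + when (q ≟ p) (+ 1))
        ≡⟨ ∑-distrib-+ (suc n) (λ q → when (prime? q ×-dec q ∣? suc c) (+ 1)) (λ q → when (q ≟ p) (+ 1)) ⟩
      ∑[ q < suc n ] when (prime? q ×-dec q ∣? suc c) (+ 1) + ∑[ q < suc n ] when (q ≟ p) (+ 1)
        ≡⟨ cong₂ _+_ (∑-truncate (suc (suc c)) (suc n) (s≤s (ℕ.m≤m*n (suc c) p)) beyond)
                     (trans (∑-single (suc n) p (s≤s (ℕ.m≤n*m p (suc c))) (λ q _ q≢p → when-no (q ≟ p) (+ 1) q≢p))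
                            (when-yes (p ≟ p) (+ 1) refl)) ⟩
      ∑[ q < suc (suc c) ] when (prime? q ×-dec q ∣? suc c) (+ 1) + + 1
        ≡⟨ cong (_+ + 1) (+length-primeDivisors (suc c)) ⟨
      + length (primeDivisors (suc c)) + + 1
        ≡⟨ cong +_ (ℕ.+-comm (length (primeDivisors (suc c))) 1) ⟩
      + suc (length (primeDivisors (suc c))) ∎)
      where
      beyond : ∀ q → suc (suc c) ≤ q → q < suc n → when (prime? q ×-dec q ∣? suc c) (+ 1) ≡ + 0
      beyond q c<q _ = when-no (prime? q ×-dec q ∣? suc c) (+ 1) (λ (_ , q∣c) → >⇒∤ c<q q∣c)

    squarefree-* : length (squaredPrimeDivisors (suc c)) ≡ 0 → length (squaredPrimeDivisors n) ≡ 0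
    squarefree-* c-squarefree with emptyOrMember (squaredPrimeDivisors n)
    ... | inj₁ n-squarefree = n-squarefree
    ... | inj₂ (x , x∈) = ⊥-elim (ℕ.<-irrefl (sym c-squarefree) (∈-length (∈-squaredPrimeDivisors-*⁻ x∈)))

    μ-*-prime-∤ : μ n ≡ - μ (suc c)
    μ-*-prime-∤ with emptyOrMember (squaredPrimeDivisors (suc c))
    ... | inj₂ (x , x∈) = trans (μ-nonsquarefree n (∈-squaredPrimeDivisors-*⁺ x∈)) (sym (cong -_ (μ-nonsquarefree (suc c) x∈)))
    ... | inj₁ c-squarefree = begin
      μ n                                        ≡⟨ μ-squarefree n (squarefree-* c-squarefree) ⟩
      sgn (length (primeDivisors n))             ≡⟨ cong sgn length-primeDivisors-* ⟩
      sgn (suc (length (primeDivisors (suc c)))) ≡⟨ sgn-suc (length (primeDivisors (suc c))) ⟩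
      - sgn (length (primeDivisors (suc c)))     ≡⟨ cong -_ (μ-squarefree (suc c) c-squarefree) ⟨
      - μ (suc c)                                ∎

-- Möbius inversion

module _ (Mp i : ℕ) (p-prime : Prime (suc i)) (1≤Mp : 1 ≤ Mp) where

  private
    p = suc i
    M = Mp *ᴺ p
    A = ∑[ c < Mp ] when (suc c ∣? Mp) (when (¬? (p ∣? suc c)) (μ (suc c)))
    divisibleByP coprimeToP : ℕ → ℤ
    divisibleByP e = when (suc e ∣? M) (when (p ∣? suc e) (μ (suc e)))
    coprimeToP e = when (suc e ∣? M) (when (¬? (p ∣? suc e)) (μ (suc e)))
    instance
      Mp≢0 : NonZero Mp
      Mp≢0 = >-nonZero 1≤Mp

    ∣M⇒∣Mp : ∀ {e} → ¬ p ∣ e → e ∣ M → e ∣ Mp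
    ∣M⇒∣Mp {e} p∤e e∣M = coprime-divisor (prime∤⇒coprime p-prime p∤e) (subst (e ∣_) (ℕ.*-comm Mp p) e∣M)

    μ-*p : ∀ c → (p∣c? : Dec (p ∣ suc c)) → μ (suc c *ᴺ p) ≡ when (¬? p∣c?) (- μ (suc c))
    μ-*p c (yes p∣c) = μ-*-prime-∣ p-prime c p∣c
    μ-*p c (no p∤c)  = μ-*-prime-∤ p-prime c p∤c

    multiples-of-p : ∑ M divisibleByP ≡ - A
    multiples-of-p = begin
      ∑[ e < M ] g (suc e)
        ≡⟨ ∑-positive-multiples i Mp g (λ a p∤a → trans (cong (when (a ∣? M)) (when-no (p ∣? a) (μ a) p∤a)) (when-0 (a ∣? M))) ⟩
      ∑[ c < Mp ] g (suc c *ᴺ p)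
        ≡⟨ ∑-ext Mp (λ c → when-cong (suc c *ᴺ p ∣? M) (suc c ∣? Mp) (*-cancelʳ-∣ p) (*-monoˡ-∣ p)
              (λ _ → trans (when-yes (p ∣? suc c *ᴺ p) (μ (suc c *ᴺ p)) (divides (suc c) refl)) (μ-*p c (p ∣? suc c)))) ⟩
      ∑[ c < Mp ] when (suc c ∣? Mp) (when (¬? (p ∣? suc c)) (- μ (suc c)))
        ≡⟨ ∑-ext Mp (λ c → trans (cong (when (suc c ∣? Mp)) (when-neg (¬? (p ∣? suc c)) (μ (suc c))))
                                 (when-neg (suc c ∣? Mp) _)) ⟩
      ∑[ c < Mp ] (- when (suc c ∣? Mp) (when (¬? (p ∣? suc c)) (μ (suc c))))
        ≡⟨ ∑-neg Mp _ ⟩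
      - A ∎
      where
      g : ℕ → ℤ
      g d = when (d ∣? M) (when (p ∣? d) (μ d))

    coprime-to-p : ∑ M coprimeToP ≡ A
    coprime-to-p = trans (∑-truncate Mp M (ℕ.m≤m*n Mp p) (λ e Mp≤e _ → beyond e Mp≤e (suc e ∣? M) (p ∣? suc e)))
                         (∑-ext Mp (λ e → restrict e (p ∣? suc e)))
      where
      beyond : ∀ e → Mp ≤ e → (e∣M? : Dec (suc e ∣ M)) (p∣e? : Dec (p ∣ suc e)) → when e∣M? (when (¬? p∣e?) (μ (suc e))) ≡ + 0
      beyond e _ e∣M? (yes _)       = when-0 e∣M?
      beyond e Mp≤e (yes e∣M) (no p∤e) = ⊥-elim (>⇒∤ (s≤s Mp≤e) (∣M⇒∣Mp p∤e e∣M))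
      beyond e _ (no _) (no _)      = refl
      restrict : ∀ e (p∣e? : Dec (p ∣ suc e)) →
        when (suc e ∣? M) (when (¬? p∣e?) (μ (suc e))) ≡ when (suc e ∣? Mp) (when (¬? p∣e?) (μ (suc e)))
      restrict e (yes _)  = trans (when-0 (suc e ∣? M)) (sym (when-0 (suc e ∣? Mp)))
      restrict e (no p∤e) = when-cong (suc e ∣? M) (suc e ∣? Mp) (∣M⇒∣Mp p∤e) (λ e∣Mp → ∣-trans e∣Mp (m∣m*n p)) (λ _ → refl)

  -- Pair each divisor prime to p with its multiple by p: their μ-values cancel.
  divisorSum-μ-*prime : divisorSum μ M ≡ + 0
  divisorSum-μ-*prime = begin
    divisorSum μ M
      ≡⟨ ∑-ext M (λ e → trans (cong (when (suc e ∣? M)) (when-split (p ∣? suc e) (μ (suc e)))) (when-+ (suc e ∣? M) _ _)) ⟩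
    ∑[ e < M ] (divisibleByP e + coprimeToP e)  ≡⟨ ∑-distrib-+ M divisibleByP coprimeToP ⟩
    ∑ M divisibleByP + ∑ M coprimeToP           ≡⟨ cong₂ _+_ multiples-of-p coprime-to-p ⟩
    - A + A                                     ≡⟨ ℤ.+-inverseˡ A ⟩
    + 0                                         ∎

primeFactor : ∀ m → ∃ λ p → Prime p × p ∣ suc (suc m)
primeFactor m = fromFactorisation factors isFactorisation factorsPrime
  where
  open PrimeFactorisation (factorise (suc (suc m)))
  fromFactorisation : ∀ fs → suc (suc m) ≡ product fs → All Prime fs → ∃ λ p → Prime p × p ∣ suc (suc m)
  fromFactorisation (q ∷ fs) eq (q-prime ∷ _) = q , q-prime , divides (product fs) (trans eq (ℕ.*-comm q (product fs)))

divisorSum-μ : ∀ M → 1 ≤ M → divisorSum μ M ≡ when (M ≟ 1) (+ 1)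
divisorSum-μ (suc zero)    _ = refl
divisorSum-μ (suc (suc m)) _ with primeFactor m
... | zero  , 0-prime , _ = ⊥-elim (¬prime[0] 0-prime)
... | suc i , p-prime , divides (suc Mp) eq =
  trans (cong (divisorSum μ) eq) (divisorSum-μ-*prime (suc Mp) i p-prime (s≤s z≤n))

when-∣≡∑ : ∀ M b (y : ℤ) → 1 ≤ M → when (suc b ∣? M) y ≡ ∑[ e < M ] when (suc e *ᴺ suc b ≟ M) y
when-∣≡∑ M b y 1≤M = byDivisibility (suc b ∣? M)
  where
  byDivisibility : (b∣M? : Dec (suc b ∣ M)) → when b∣M? y ≡ ∑[ e < M ] when (suc e *ᴺ suc b ≟ M) y
  byDivisibility (no b∤M) = sym (∑-vanishing M (λ e _ → when-no (suc e *ᴺ suc b ≟ M) y (λ eq → b∤M (divides (suc e) (sym eq)))))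
  byDivisibility (yes (divides zero M≡0)) = ⊥-elim (ℕ.<-irrefl (sym M≡0) 1≤M)
  byDivisibility (yes (divides (suc q) M≡q*b)) = sym (trans (∑-single M q q<M others) (when-yes (suc q *ᴺ suc b ≟ M) y (sym M≡q*b)))
    where
    q<M : q < M
    q<M = subst (q <_) (sym M≡q*b) (ℕ.m≤m*n (suc q) (suc b))
    others : ∀ e → e < M → e ≢ q → when (suc e *ᴺ suc b ≟ M) y ≡ + 0
    others e _ e≢q = when-no (suc e *ᴺ suc b ≟ M) y
      (λ eq → e≢q (ℕ.suc-injective (ℕ.*-cancelʳ-≡ (suc e) (suc q) (suc b) (trans eq M≡q*b))))

divisorSum-cofactor : ∀ M (g : ℕ → ℤ) → 1 ≤ M →
  divisorSum g M ≡ ∑[ c < M ] when (suc c ∣? M) (g (M / suc c))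
divisorSum-cofactor M g 1≤M = begin
  ∑[ e < M ] when (suc e ∣? M) (g (suc e))
    ≡⟨ ∑-ext M (λ e → when-∣≡∑ M e (g (suc e)) 1≤M) ⟩
  ∑[ e < M ] ∑[ c < M ] when (suc c *ᴺ suc e ≟ M) (g (suc e))
    ≡⟨ ∑-comm M M _ ⟩
  ∑[ c < M ] ∑[ e < M ] when (suc c *ᴺ suc e ≟ M) (g (suc e))
    ≡⟨ ∑-ext M (λ c → ∑-ext M (λ e → swap c e)) ⟩
  ∑[ c < M ] ∑[ e < M ] when (suc e *ᴺ suc c ≟ M) (g (M / suc c))
    ≡⟨ ∑-ext M (λ c → when-∣≡∑ M c (g (M / suc c)) 1≤M) ⟨
  ∑[ c < M ] when (suc c ∣? M) (g (M / suc c)) ∎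
  where
  swap : ∀ c e → when (suc c *ᴺ suc e ≟ M) (g (suc e)) ≡ when (suc e *ᴺ suc c ≟ M) (g (M / suc c))
  swap c e = when-cong (suc c *ᴺ suc e ≟ M) (suc e *ᴺ suc c ≟ M)
    (trans (ℕ.*-comm (suc e) (suc c))) (trans (ℕ.*-comm (suc c) (suc e)))
    (λ ce≡M → cong g (sym (trans (cong (_/ suc c) (sym (trans (ℕ.*-comm (suc e) (suc c)) ce≡M))) (m*n/n≡m (suc e) (suc c)))))

∑-μ-between : ∀ N i → 1 ≤ N →
  ∑[ j < N ] when (suc j ∣? N) (when (suc i ∣? suc j) (μ (N / suc j))) ≡ when (suc i ≟ N) (+ 1)
∑-μ-between N i 1≤N = byDivisibility N 1≤N (suc i ∣? N)
  where
  byDivisibility : ∀ N → 1 ≤ N → Dec (suc i ∣ N) →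
    ∑[ j < N ] when (suc j ∣? N) (when (suc i ∣? suc j) (μ (N / suc j))) ≡ when (suc i ≟ N) (+ 1)
  byDivisibility N _ (no i∤N) = trans (∑-vanishing N (λ j _ → vanish (suc j ∣? N) (suc i ∣? suc j)))
                                      (sym (when-no (suc i ≟ N) (+ 1) (λ i≡N → i∤N (subst (suc i ∣_) i≡N ∣-refl))))
    where
    vanish : ∀ {j x} (j∣N? : Dec (suc j ∣ N)) (i∣j? : Dec (suc i ∣ suc j)) → when j∣N? (when i∣j? x) ≡ + 0
    vanish (yes j∣N) (yes i∣j) = ⊥-elim (i∤N (∣-trans i∣j j∣N))
    vanish (yes _)   (no _)    = refl
    vanish (no _)    _         = refl
  byDivisibility .(M *ᴺ suc i) 1≤N (yes (divides M refl)) = begin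
    ∑[ j < M *ᴺ suc i ] g (suc j)
      ≡⟨ ∑-positive-multiples i M g g-vanishes ⟩
    ∑[ c < M ] g (suc c *ᴺ suc i)
      ≡⟨ ∑-ext M (λ c → when-cong (suc c *ᴺ suc i ∣? M *ᴺ suc i) (suc c ∣? M) (*-cancelʳ-∣ (suc i)) (*-monoˡ-∣ (suc i))
            (λ _ → trans (when-yes (suc i ∣? suc c *ᴺ suc i) _ (divides (suc c) refl))
                         (cong μ (m*n/o*n≡m/o M (suc i) (suc c))))) ⟩
    ∑[ c < M ] when (suc c ∣? M) (μ (M / suc c))
      ≡⟨ divisorSum-cofactor M μ 1≤M ⟨
    divisorSum μ M
      ≡⟨ divisorSum-μ M 1≤M ⟩
    when (M ≟ 1) (+ 1)
      ≡⟨ when-cong (M ≟ 1) (suc i ≟ M *ᴺ suc i)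
           (λ M≡1 → sym (trans (cong (_*ᴺ suc i) M≡1) (ℕ.*-identityˡ (suc i))))
           (λ i≡Mi → sym (ℕ.*-cancelʳ-≡ 1 M (suc i) (trans (ℕ.*-identityˡ (suc i)) i≡Mi))) (λ _ → refl) ⟩
    when (suc i ≟ M *ᴺ suc i) (+ 1) ∎
    where
    g : ℕ → ℤ
    g zero    = + 0
    g (suc j) = when (suc j ∣? M *ᴺ suc i) (when (suc i ∣? suc j) (μ (M *ᴺ suc i / suc j)))
    g-vanishes : ∀ a → ¬ suc i ∣ a → g a ≡ + 0
    g-vanishes zero    _   = refl
    g-vanishes (suc a) i∤a = trans (cong (when (suc a ∣? M *ᴺ suc i)) (when-no (suc i ∣? suc a) _ i∤a)) (when-0 (suc a ∣? M *ᴺ suc i))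
    positive : ∀ M → 1 ≤ M *ᴺ suc i → 1 ≤ M
    positive (suc _) _ = s≤s z≤n
    1≤M : 1 ≤ M
    1≤M = positive M 1≤N

möbius-inversion : ∀ (f : ℕ → ℤ) N → 1 ≤ N →
  ∑[ j < N ] when (suc j ∣? N) (μ (N / suc j) * divisorSum f (suc j)) ≡ f N
möbius-inversion f N@(suc n) 1≤N = begin
  ∑[ j < N ] when (suc j ∣? N) (μ (N / suc j) * divisorSum f (suc j))
    ≡⟨ ∑-cong N expand ⟩
  ∑[ j < N ] ∑[ i < N ] E j i
    ≡⟨ ∑-comm N N E ⟩
  ∑[ i < N ] ∑[ j < N ] E j i
    ≡⟨ ∑-ext N (λ i → trans (∑-*ʳ N (f (suc i)) (λ j → when (suc j ∣? N) (when (suc i ∣? suc j) (μ (N / suc j)))))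
                            (cong (_* f (suc i)) (∑-μ-between N i 1≤N))) ⟩
  ∑[ i < N ] (when (suc i ≟ N) (+ 1) * f (suc i))
    ≡⟨ ∑-single N n (ℕ.n<1+n n) (λ i _ i≢n → cong (_* f (suc i)) (when-no (suc i ≟ N) (+ 1) (i≢n ∘ ℕ.suc-injective))) ⟩
  when (N ≟ N) (+ 1) * f N
    ≡⟨ cong (_* f N) (when-yes (N ≟ N) (+ 1) refl) ⟩
  + 1 * f N
    ≡⟨ ℤ.*-identityˡ (f N) ⟩
  f N ∎
  where
  E : ℕ → ℕ → ℤ
  E j i = when (suc j ∣? N) (when (suc i ∣? suc j) (μ (N / suc j))) * f (suc i)
  expand : ∀ j → j < N → when (suc j ∣? N) (μ (N / suc j) * divisorSum f (suc j)) ≡ ∑[ i < N ] E j i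
  expand j j<N = begin
    when (suc j ∣? N) (μ′ * divisorSum f (suc j))
      ≡⟨ cong (when (suc j ∣? N)) (∑-*ˡ (suc j) μ′ (λ i → when (suc i ∣? suc j) (f (suc i)))) ⟨
    when (suc j ∣? N) (∑[ i < suc j ] (μ′ * when (suc i ∣? suc j) (f (suc i))))
      ≡⟨ cong (when (suc j ∣? N)) (∑-ext (suc j) (λ i → *-when μ′ (suc i ∣? suc j) (f (suc i)))) ⟩
    when (suc j ∣? N) (∑[ i < suc j ] when (suc i ∣? suc j) (μ′ * f (suc i)))
      ≡⟨ cong (when (suc j ∣? N))
              (∑-truncate (suc j) N j<N (λ i j<i _ → when-no (suc i ∣? suc j) (μ′ * f (suc i)) (>⇒∤ (s≤s j<i)))) ⟨
    when (suc j ∣? N) (∑[ i < N ] when (suc i ∣? suc j) (μ′ * f (suc i)))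
      ≡⟨ when-∑ (suc j ∣? N) N (λ i → when (suc i ∣? suc j) (μ′ * f (suc i))) ⟩
    ∑[ i < N ] when (suc j ∣? N) (when (suc i ∣? suc j) (μ′ * f (suc i)))
      ≡⟨ ∑-ext N (λ i → trans (cong (when (suc j ∣? N)) (when-*ʳ (suc i ∣? suc j) μ′ (f (suc i))))
                              (when-*ʳ (suc j ∣? N) (when (suc i ∣? suc j) μ′) (f (suc i)))) ⟩
    ∑[ i < N ] E j i ∎
    where
    μ′ = μ (N / suc j)

-- Logarithmic derivatives of the factors

[1+k]*[1+n]C[1+k]≡[1+n]*nCk : ∀ n k → suc k *ᴺ (suc n C suc k) ≡ suc n *ᴺ (n C k)
[1+k]*[1+n]C[1+k]≡[1+n]*nCk zero    zero    = refl
[1+k]*[1+n]C[1+k]≡[1+n]*nCk zero    (suc k) = ℕ.*-zeroʳ (suc (suc k))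
[1+k]*[1+n]C[1+k]≡[1+n]*nCk (suc n) zero    =
  trans (ℕ.+-identityʳ _) (trans (nC1≡n (suc (suc n))) (sym (ℕ.*-identityʳ (suc (suc n)))))
[1+k]*[1+n]C[1+k]≡[1+n]*nCk (suc n) (suc k) = begin
  suc (suc k) *ᴺ (suc (suc n) C suc (suc k))
    ≡⟨ cong (suc (suc k) *ᴺ_) (nCk+nC[k+1]≡[n+1]C[k+1] (suc n) (suc k)) ⟨
  suc (suc k) *ᴺ (x +ᴺ y)                         ≡⟨ expand k x y ⟩
  x +ᴺ suc k *ᴺ x +ᴺ suc (suc k) *ᴺ y
    ≡⟨ cong₂ (λ u w → x +ᴺ u +ᴺ w) ([1+k]*[1+n]C[1+k]≡[1+n]*nCk n k) ([1+k]*[1+n]C[1+k]≡[1+n]*nCk n (suc k)) ⟩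
  x +ᴺ suc n *ᴺ (n C k) +ᴺ suc n *ᴺ (n C suc k)   ≡⟨ collect x n (n C k) (n C suc k) ⟩
  x +ᴺ suc n *ᴺ ((n C k) +ᴺ (n C suc k))          ≡⟨ cong (λ z → x +ᴺ suc n *ᴺ z) (nCk+nC[k+1]≡[n+1]C[k+1] n k) ⟩
  x +ᴺ suc n *ᴺ x                                 ∎
  where
  x = suc n C suc k
  y = suc n C suc (suc k)
  expand : ∀ k x y → suc (suc k) *ᴺ (x +ᴺ y) ≡ x +ᴺ suc k *ᴺ x +ᴺ suc (suc k) *ᴺ y
  expand = ℕ-Solver.solve-∀
  collect : ∀ x n p q → x +ᴺ suc n *ᴺ p +ᴺ suc n *ᴺ q ≡ x +ᴺ suc n *ᴺ (p +ᴺ q)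
  collect = ℕ-Solver.solve-∀

[1+j]*mC[1+j]+j*mCj≡m*mCj : ∀ m j → suc j *ᴺ (m C suc j) +ᴺ j *ᴺ (m C j) ≡ m *ᴺ (m C j)
[1+j]*mC[1+j]+j*mCj≡m*mCj zero    zero    = refl
[1+j]*mC[1+j]+j*mCj≡m*mCj zero    (suc j) = cong₂ _+ᴺ_ (ℕ.*-zeroʳ (suc (suc j))) (ℕ.*-zeroʳ (suc j))
[1+j]*mC[1+j]+j*mCj≡m*mCj (suc n) zero    =
  trans (ℕ.+-identityʳ _) (trans (ℕ.+-identityʳ _) (trans (nC1≡n (suc n)) (sym (ℕ.*-identityʳ (suc n)))))
[1+j]*mC[1+j]+j*mCj≡m*mCj (suc n) (suc j) = begin
  suc (suc j) *ᴺ (suc n C suc (suc j)) +ᴺ suc j *ᴺ (suc n C suc j)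
    ≡⟨ cong₂ _+ᴺ_ ([1+k]*[1+n]C[1+k]≡[1+n]*nCk n (suc j)) ([1+k]*[1+n]C[1+k]≡[1+n]*nCk n j) ⟩
  suc n *ᴺ (n C suc j) +ᴺ suc n *ᴺ (n C j)  ≡⟨ factorOut (suc n) (n C suc j) (n C j) ⟩
  suc n *ᴺ ((n C j) +ᴺ (n C suc j))         ≡⟨ cong (suc n *ᴺ_) (nCk+nC[k+1]≡[n+1]C[k+1] n j) ⟩
  suc n *ᴺ (suc n C suc j)                  ∎
  where
  factorOut : ∀ a b c → a *ᴺ b +ᴺ a *ᴺ c ≡ a *ᴺ (c +ᴺ b)
  factorOut = ℕ-Solver.solve-∀

symDim-suc : ∀ m j → suc j *ᴺ symDim m (suc j) ≡ (j +ᴺ m) *ᴺ symDim m j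
symDim-suc zero j = trans (cong (suc j *ᴺ_) (k>n⇒nCk≡0 (ℕ.n<1+n j))) (trans (ℕ.*-zeroʳ (suc j)) (sym (vanish j)))
  where
  vanish : ∀ j → (j +ᴺ 0) *ᴺ symDim 0 j ≡ 0
  vanish zero    = refl
  vanish (suc j) = trans (cong ((suc j +ᴺ 0) *ᴺ_) (k>n⇒nCk≡0 (ℕ.n<1+n j))) (ℕ.*-zeroʳ (suc j +ᴺ 0))
symDim-suc (suc n) j = begin
  suc j *ᴺ ((n +ᴺ suc j) C suc j)   ≡⟨ cong (λ z → suc j *ᴺ (z C suc j)) (ℕ.+-suc n j) ⟩
  suc j *ᴺ (suc (n +ᴺ j) C suc j)   ≡⟨ [1+k]*[1+n]C[1+k]≡[1+n]*nCk (n +ᴺ j) j ⟩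
  suc (n +ᴺ j) *ᴺ ((n +ᴺ j) C j)    ≡⟨ cong (_*ᴺ ((n +ᴺ j) C j)) (trans (sym (ℕ.+-suc n j)) (ℕ.+-comm n (suc j))) ⟩
  (suc j +ᴺ n) *ᴺ ((n +ᴺ j) C j)    ≡⟨ cong (_*ᴺ ((n +ᴺ j) C j)) (sym (ℕ.+-suc j n)) ⟩
  (j +ᴺ suc n) *ᴺ ((n +ᴺ j) C j)    ∎

-- Coefficient of x^j in x d/dx (1 + x)^m = (1 + x)^m · m x/(1 + x).
extDim-logDeriv : ∀ m j → + m * ∑[ a < j ] (+ extDim m a * sgn (j ∸ suc a)) ≡ + j * + extDim m j
extDim-logDeriv m zero    = ℤ.*-zeroʳ (+ m)
extDim-logDeriv m (suc j) = begin
  + m * T (suc j)                         ≡⟨ cong (+ m *_) T-suc ⟩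
  + m * (- T j + + (m C j))               ≡⟨ distrib (+ m) (T j) _ ⟩
  - (+ m * T j) + + m * + (m C j)         ≡⟨ cong (λ z → - z + + m * + (m C j)) (extDim-logDeriv m j) ⟩
  - (+ j * + (m C j)) + + m * + (m C j)   ≡⟨ cong (λ z → - (+ j * + (m C j)) + z) absorption ⟨
  - (+ j * + (m C j)) + (+ suc j * + (m C suc j) + + j * + (m C j)) ≡⟨ cancel (+ suc j * + (m C suc j)) (+ j * + (m C j)) ⟩
  + suc j * + (m C suc j)                 ∎
  where
  T : ℕ → ℤ
  T j = ∑[ a < j ] (+ extDim m a * sgn (j ∸ suc a))
  T-suc : T (suc j) ≡ - T j + + (m C j)
  T-suc = begin
    ∑[ a < suc j ] (+ (m C a) * sgn (j ∸ a))             ≡⟨ ∑-last j (λ a → + (m C a) * sgn (j ∸ a)) ⟩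
    ∑[ a < j ] (+ (m C a) * sgn (j ∸ a)) + + (m C j) * sgn (j ∸ j)
      ≡⟨ cong₂ _+_ (∑-cong j (λ a a<j → flip a a<j)) (trans (cong (λ z → + (m C j) * sgn z) (ℕ.n∸n≡0 j)) (ℤ.*-identityʳ _)) ⟩
    ∑[ a < j ] (- (+ (m C a) * sgn (j ∸ suc a))) + + (m C j) ≡⟨ cong (_+ + (m C j)) (∑-neg j (λ a → + (m C a) * sgn (j ∸ suc a))) ⟩
    - T j + + (m C j)                                      ∎
    where
    flip : ∀ a → a < j → + (m C a) * sgn (j ∸ a) ≡ - (+ (m C a) * sgn (j ∸ suc a))
    flip a a<j = trans (cong (λ z → + (m C a) * sgn z) (ℕ.+-∸-assoc 1 a<j))
                 (trans (cong (+ (m C a) *_) (sgn-suc (j ∸ suc a))) (sym (ℤ.neg-distribʳ-* (+ (m C a)) _)))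
  absorption : + suc j * + (m C suc j) + + j * + (m C j) ≡ + m * + (m C j)
  absorption = begin
    + suc j * + (m C suc j) + + j * + (m C j) ≡⟨ cong₂ _+_ (ℤ.pos-* (suc j) _) (ℤ.pos-* j _) ⟨
    + (suc j *ᴺ (m C suc j) +ᴺ j *ᴺ (m C j))  ≡⟨ cong +_ ([1+j]*mC[1+j]+j*mCj≡m*mCj m j) ⟩
    + (m *ᴺ (m C j))                          ≡⟨ ℤ.pos-* m _ ⟩
    + m * + (m C j)                           ∎
  distrib : ∀ a t c → a * (- t + c) ≡ - (a * t) + a * c
  distrib = solve-∀
  cancel : ∀ x y → - y + (x + y) ≡ x
  cancel = solve-∀

-- Coefficient of x^j in x d/dx (1 - x)^(-m) = (1 - x)^(-m) · m x/(1 - x).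
symDim-logDeriv : ∀ m j → + m * ∑[ a < j ] (+ symDim m a) ≡ + j * + symDim m j
symDim-logDeriv m zero    = ℤ.*-zeroʳ (+ m)
symDim-logDeriv m (suc j) = begin
  + m * ∑[ a < suc j ] (+ symDim m a)               ≡⟨ cong (+ m *_) (∑-last j (λ a → + symDim m a)) ⟩
  + m * (∑[ a < j ] (+ symDim m a) + + symDim m j)  ≡⟨ ℤ.*-distribˡ-+ (+ m) _ _ ⟩
  + m * ∑[ a < j ] (+ symDim m a) + + m * + symDim m j
    ≡⟨ cong (_+ + m * + symDim m j) (symDim-logDeriv m j) ⟩
  + j * + symDim m j + + m * + symDim m j           ≡⟨ ℤ.*-distribʳ-+ (+ symDim m j) (+ j) (+ m) ⟨
  + (j +ᴺ m) * + symDim m j                         ≡⟨ ℤ.pos-* (j +ᴺ m) _ ⟨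
  + ((j +ᴺ m) *ᴺ symDim m j)                        ≡⟨ cong +_ (symDim-suc m j) ⟨
  + (suc j *ᴺ symDim m (suc j))                     ≡⟨ ℤ.pos-* (suc j) _ ⟩
  + suc j * + symDim m (suc j)                      ∎

-- Coefficients of t d/dt log of the factor generated in degree i = suc k with
-- m = v i generators: i m t^i/(1 - t^i) for i even, i m t^i/(1 + t^i) for i odd.
factorLogDeriv : (ℕ → ℕ) → ℕ → ℕ → ℤ
factorLogDeriv v k zero    = + 0
factorLogDeriv v k (suc n) = when (suc k ∣? suc n) (sgn (suc n +ᴺ suc k) * (+ suc k * + v (suc k)))

module _ (v : ℕ → ℕ) (k : ℕ) where

  private
    i = suc k
    m = v i
    W = + i * + m
    F : ℕ → ℤ
    F n = + factor v k n
    ℓ = factorLogDeriv v k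

  factor-nondivisible : ∀ n → ¬ i ∣ n → factor v k n ≡ 0
  factor-nondivisible n i∤n with i ∣? n
  ... | yes i∣n = ⊥-elim (i∤n i∣n)
  ... | no _    = refl

  factor-even : ∀ a → 2 ∣ i → factor v k (a *ᴺ i) ≡ symDim m a
  factor-even a 2∣i with i ∣? a *ᴺ i | 2 ∣? i
  ... | yes _ | yes _   = cong (symDim m) (m*n/n≡m a i)
  ... | yes _ | no 2∤i  = ⊥-elim (2∤i 2∣i)
  ... | no i∤ai | _     = ⊥-elim (i∤ai (divides a refl))

  factor-odd : ∀ a → ¬ 2 ∣ i → factor v k (a *ᴺ i) ≡ extDim m a
  factor-odd a 2∤i with i ∣? a *ᴺ i | 2 ∣? i
  ... | yes _ | yes 2∣i = ⊥-elim (2∤i 2∣i)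
  ... | yes _ | no _    = cong (extDim m) (m*n/n≡m a i)
  ... | no i∤ai | _     = ⊥-elim (i∤ai (divides a refl))

  factorLogDeriv-nondivisible : ∀ n → ¬ i ∣ n → ℓ n ≡ + 0
  factorLogDeriv-nondivisible zero    _ = refl
  factorLogDeriv-nondivisible (suc n) i∤n = when-no (i ∣? suc n) _ i∤n

  factorLogDeriv-multiple : ∀ b → ℓ (suc b *ᴺ i) ≡ sgn (suc (suc b) *ᴺ i) * W
  factorLogDeriv-multiple b = trans (when-yes (i ∣? suc b *ᴺ i) _ (divides (suc b) refl))
                                    (cong (λ n → sgn n * W) (ℕ.+-comm (suc b *ᴺ i) i))

  ⋆factorLogDeriv-multiple : ∀ j →
    (F ⋆ ℓ) (j *ᴺ i) ≡ ∑[ a < j ] (F (a *ᴺ i) * (sgn (suc (suc (j ∸ suc a)) *ᴺ i) * W))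
  ⋆factorLogDeriv-multiple j = begin
    (F ⋆ ℓ) (j *ᴺ i)
      ≡⟨ ∑-multiples k j (λ a → F a * ℓ (j *ᴺ i ∸ a)) (λ a i∤a → cong (λ z → + z * ℓ (j *ᴺ i ∸ a)) (factor-nondivisible a i∤a)) ⟩
    ∑[ a < suc j ] (F (a *ᴺ i) * ℓ (j *ᴺ i ∸ a *ᴺ i))
      ≡⟨ ∑-ext (suc j) (λ a → cong (λ z → F (a *ᴺ i) * ℓ z) (ℕ.*-distribʳ-∸ i j a)) ⟨
    ∑[ a < suc j ] (F (a *ᴺ i) * ℓ ((j ∸ a) *ᴺ i))
      ≡⟨ ∑-last j (λ a → F (a *ᴺ i) * ℓ ((j ∸ a) *ᴺ i)) ⟩
    ∑[ a < j ] (F (a *ᴺ i) * ℓ ((j ∸ a) *ᴺ i)) + F (j *ᴺ i) * ℓ ((j ∸ j) *ᴺ i)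
      ≡⟨ cong₂ _+_ (∑-cong j (λ a a<j → cong (F (a *ᴺ i) *_) (term a a<j)))
                   (trans (cong (λ z → F (j *ᴺ i) * ℓ (z *ᴺ i)) (ℕ.n∸n≡0 j)) (ℤ.*-zeroʳ (F (j *ᴺ i)))) ⟩
    ∑[ a < j ] (F (a *ᴺ i) * (sgn (suc (suc (j ∸ suc a)) *ᴺ i) * W)) + + 0
      ≡⟨ ℤ.+-identityʳ _ ⟩
    ∑[ a < j ] (F (a *ᴺ i) * (sgn (suc (suc (j ∸ suc a)) *ᴺ i) * W)) ∎
    where
    term : ∀ a → a < j → ℓ ((j ∸ a) *ᴺ i) ≡ sgn (suc (suc (j ∸ suc a)) *ᴺ i) * W
    term a a<j = trans (cong (λ z → ℓ (z *ᴺ i)) (ℕ.+-∸-assoc 1 a<j)) (factorLogDeriv-multiple (j ∸ suc a))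

  private
    rescale : ∀ j X (c : ℕ → ℤ) → + m * ∑ j c ≡ + j * X → + j * + i * X ≡ ∑[ a < j ] (c a * W)
    rescale j X c eq = begin
      + j * + i * X        ≡⟨ swap (+ j) (+ i) X ⟩
      + i * (+ j * X)      ≡⟨ cong (+ i *_) eq ⟨
      + i * (+ m * ∑ j c)  ≡⟨ swap′ (+ i) (+ m) (∑ j c) ⟩
      ∑ j c * W            ≡⟨ ∑-*ʳ j W c ⟨
      ∑[ a < j ] (c a * W) ∎
      where
      swap : ∀ x y z → x * y * z ≡ y * (x * z)
      swap = solve-∀
      swap′ : ∀ x y z → x * (y * z) ≡ z * (x * y)
      swap′ = solve-∀

  δfactor-multiple-even : ∀ j → 2 ∣ i →
    δ F (j *ᴺ i) ≡ ∑[ a < j ] (F (a *ᴺ i) * (sgn (suc (suc (j ∸ suc a)) *ᴺ i) * W))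
  δfactor-multiple-even j 2∣i = begin
    + (j *ᴺ i) * F (j *ᴺ i)       ≡⟨ cong₂ (λ x y → x * + y) (ℤ.pos-* j i) (factor-even j 2∣i) ⟩
    + j * + i * + symDim m j      ≡⟨ rescale j _ (λ a → + symDim m a) (symDim-logDeriv m j) ⟩
    ∑[ a < j ] (+ symDim m a * W) ≡⟨ ∑-ext j term ⟩
    ∑[ a < j ] (F (a *ᴺ i) * (sgn (suc (suc (j ∸ suc a)) *ᴺ i) * W)) ∎
    where
    term : ∀ a → + symDim m a * W ≡ F (a *ᴺ i) * (sgn (suc (suc (j ∸ suc a)) *ᴺ i) * W)
    term a = sym (cong₂ _*_ (cong +_ (factor-even a 2∣i))
                            (trans (cong (_* W) (sgn-*-even (suc (suc (j ∸ suc a))) i 2∣i)) (ℤ.*-identityˡ W)))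
  δfactor-multiple-odd : ∀ j → ¬ 2 ∣ i →
    δ F (j *ᴺ i) ≡ ∑[ a < j ] (F (a *ᴺ i) * (sgn (suc (suc (j ∸ suc a)) *ᴺ i) * W))
  δfactor-multiple-odd j 2∤i = begin
    + (j *ᴺ i) * F (j *ᴺ i)       ≡⟨ cong₂ (λ x y → x * + y) (ℤ.pos-* j i) (factor-odd j 2∤i) ⟩
    + j * + i * + extDim m j      ≡⟨ rescale j _ (λ a → + extDim m a * sgn (j ∸ suc a)) (extDim-logDeriv m j) ⟩
    ∑[ a < j ] (+ extDim m a * sgn (j ∸ suc a) * W) ≡⟨ ∑-ext j term ⟩
    ∑[ a < j ] (F (a *ᴺ i) * (sgn (suc (suc (j ∸ suc a)) *ᴺ i) * W)) ∎
    where
    term : ∀ a → + extDim m a * sgn (j ∸ suc a) * W ≡ F (a *ᴺ i) * (sgn (suc (suc (j ∸ suc a)) *ᴺ i) * W)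
    term a = trans (ℤ.*-assoc (+ extDim m a) _ W)
               (sym (cong₂ _*_ (cong +_ (factor-odd a 2∤i))
                               (cong (_* W) (trans (sgn-*-odd (suc (suc (j ∸ suc a))) i 2∤i) (sgn-suc-suc (j ∸ suc a))))))

  δfactor-multiple : ∀ j → δ F (j *ᴺ i) ≡ ∑[ a < j ] (F (a *ᴺ i) * (sgn (suc (suc (j ∸ suc a)) *ᴺ i) * W))
  δfactor-multiple j = byParity (2 ∣? i)
    where
    byParity : Dec (2 ∣ i) → δ F (j *ᴺ i) ≡ ∑[ a < j ] (F (a *ᴺ i) * (sgn (suc (suc (j ∸ suc a)) *ᴺ i) * W))
    byParity (yes 2∣i) = δfactor-multiple-even j 2∣i
    byParity (no 2∤i)  = δfactor-multiple-odd j 2∤i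

  δfactor : ∀ n → δ F n ≡ (F ⋆ ℓ) n
  δfactor n = byDivisibility (i ∣? n)
    where
    byDivisibility : Dec (i ∣ n) → δ F n ≡ (F ⋆ ℓ) n
    byDivisibility (yes (divides j refl)) = trans (δfactor-multiple j) (sym (⋆factorLogDeriv-multiple j))
    byDivisibility (no i∤n) = begin
      + n * F n   ≡⟨ cong (λ z → + n * + z) (factor-nondivisible n i∤n) ⟩
      + n * + 0   ≡⟨ ℤ.*-zeroʳ (+ n) ⟩
      + 0         ≡⟨ ∑-vanishing (suc n) (λ a a≤n → vanish a (ℕ.≤-pred a≤n)) ⟨
      (F ⋆ ℓ) n   ∎
      where
      vanish : ∀ a → a ≤ n → F a * ℓ (n ∸ a) ≡ + 0
      vanish a a≤n = byDivisibilityᵃ (i ∣? a)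
        where
        byDivisibilityᵃ : Dec (i ∣ a) → F a * ℓ (n ∸ a) ≡ + 0
        byDivisibilityᵃ (no i∤a)  = cong (λ z → + z * ℓ (n ∸ a)) (factor-nondivisible a i∤a)
        byDivisibilityᵃ (yes i∣a) =
          trans (cong (F a *_) (factorLogDeriv-nondivisible (n ∸ a) (λ i∣n∸a → i∤n (∣m∸n∣n⇒∣m i a≤n i∣n∸a i∣a))))
                (ℤ.*-zeroʳ (F a))

-- The Poincaré series of S(V)

signedWeightedDim : (ℕ → ℕ) → ℕ → ℤ
signedWeightedDim v i = sgn (suc i) * (+ i * + v i)

module _ (v : ℕ → ℕ) where

  private
    P : ℕ → ℕ → ℤ
    P K n = + partialProduct v K n
    F : ℕ → ℕ → ℤ
    F K n = + factor v K n
    s : ℕ → ℤ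
    s n = + poincareS v n

  logDeriv : ℕ → ℕ → ℤ
  logDeriv K n = ∑[ k < K ] factorLogDeriv v k n

  factor-zero : ∀ K → factor v K 0 ≡ 1
  factor-zero K with suc K ∣? 0 | 2 ∣? suc K
  ... | yes _ | yes _ = refl
  ... | yes _ | no _  = refl
  ... | no K+1∤0 | _  = ⊥-elim (K+1∤0 (divides 0 refl))

  partialProduct-suc : ∀ K n → P (suc K) n ≡ (P K ⋆ F K) n
  partialProduct-suc K = conv≡⋆ (partialProduct v K) (factor v K)

  -- The factor generated in degree suc K is 1 + O(t^(suc K)).
  partialProduct-stable-suc : ∀ K n → n ≤ K → P (suc K) n ≡ P K n
  partialProduct-stable-suc K n n≤K = begin
    P (suc K) n       ≡⟨ partialProduct-suc K n ⟩
    (P K ⋆ F K) n     ≡⟨ ∑-single (suc n) n ℕ.≤-refl high ⟩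
    P K n * F K (n ∸ n) ≡⟨ cong (λ z → P K n * + factor v K z) (ℕ.n∸n≡0 n) ⟩
    P K n * F K 0     ≡⟨ cong (λ z → P K n * + z) (factor-zero K) ⟩
    P K n * + 1       ≡⟨ ℤ.*-identityʳ (P K n) ⟩
    P K n             ∎
    where
    high : ∀ a → a < suc n → a ≢ n → P K a * F K (n ∸ a) ≡ + 0
    high a a≤n a≢n = trans (cong (λ z → P K a * + z) (factor-nondivisible v K (n ∸ a) K+1∤n∸a)) (ℤ.*-zeroʳ (P K a))
      where
      a<n : a < n
      a<n = ℕ.≤∧≢⇒< (ℕ.≤-pred a≤n) a≢n
      instance
        n∸a≢0 : NonZero (n ∸ a)
        n∸a≢0 = >-nonZero (ℕ.m<n⇒0<n∸m a<n)
      K+1∤n∸a : ¬ suc K ∣ n ∸ a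
      K+1∤n∸a = >⇒∤ (s≤s (ℕ.≤-trans (ℕ.m∸n≤m n a) n≤K))

  partialProduct-stable : ∀ {K n} → n ≤′ K → P K n ≡ s n
  partialProduct-stable ≤′-refl = refl
  partialProduct-stable {suc K} {n} (≤′-step n≤′K) =
    trans (partialProduct-stable-suc K n (ℕ.≤′⇒≤ n≤′K)) (partialProduct-stable n≤′K)

  δpartialProduct : ∀ K n → δ (P K) n ≡ (P K ⋆ logDeriv K) n
  δpartialProduct zero n = trans (δP₀ n) (sym (∑-vanishing (suc n) (λ a _ → ℤ.*-zeroʳ (P 0 a))))
    where
    δP₀ : ∀ n → δ (P 0) n ≡ + 0
    δP₀ zero    = refl
    δP₀ (suc n) = ℤ.*-zeroʳ (+ suc n)
  δpartialProduct (suc K) n = begin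
    δ (P (suc K)) n
      ≡⟨ cong (+ n *_) (partialProduct-suc K n) ⟩
    δ (P K ⋆ F K) n
      ≡⟨ δ-⋆ (P K) (F K) n ⟩
    (δ (P K) ⋆ F K) n + (P K ⋆ δ (F K)) n
      ≡⟨ cong₂ _+_ (⋆-cong {δ (P K)} {P K ⋆ L K} {F K} {F K} n (λ a _ → δpartialProduct K a) (λ _ _ → refl))
                   (⋆-cong {P K} {P K} {δ (F K)} {F K ⋆ ℓ} n (λ _ _ → refl) (λ a _ → δfactor v K a)) ⟩
    ((P K ⋆ L K) ⋆ F K) n + (P K ⋆ (F K ⋆ ℓ)) n
      ≡⟨ cong (_+ (P K ⋆ (F K ⋆ ℓ)) n) (⋆-assoc (P K) (L K) (F K) n) ⟩
    (P K ⋆ (L K ⋆ F K)) n + (P K ⋆ (F K ⋆ ℓ)) n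
      ≡⟨ cong (_+ (P K ⋆ (F K ⋆ ℓ)) n)
              (⋆-cong {P K} {P K} {L K ⋆ F K} {F K ⋆ L K} n (λ _ _ → refl) (λ a _ → ⋆-comm (L K) (F K) a)) ⟩
    (P K ⋆ (F K ⋆ L K)) n + (P K ⋆ (F K ⋆ ℓ)) n
      ≡⟨ ⋆-distribˡ-+ (P K) (F K ⋆ L K) (F K ⋆ ℓ) n ⟨
    (P K ⋆ (λ c → (F K ⋆ L K) c + (F K ⋆ ℓ) c)) n
      ≡⟨ ⋆-cong {P K} {P K} {F K ⋆ (λ c → L K c + ℓ c)} n
                (λ _ _ → refl) (λ c _ → ⋆-distribˡ-+ (F K) (L K) ℓ c) ⟨
    (P K ⋆ (F K ⋆ (λ c → L K c + ℓ c))) n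
      ≡⟨ ⋆-assoc (P K) (F K) (λ c → L K c + ℓ c) n ⟨
    ((P K ⋆ F K) ⋆ (λ c → L K c + ℓ c)) n
      ≡⟨ ⋆-cong {P K ⋆ F K} {P (suc K)} {λ c → L K c + ℓ c} {L (suc K)} n
                (λ a _ → sym (partialProduct-suc K a)) (λ c _ → sym (∑-last K (λ k → factorLogDeriv v k c))) ⟩
    (P (suc K) ⋆ L (suc K)) n ∎
    where
    L = logDeriv
    ℓ = factorLogDeriv v K

  δpoincareS : ∀ N d → d ≤ N → δ s d ≡ (logDeriv N ⋆ s) d
  δpoincareS N d d≤N = begin
    + d * s d             ≡⟨ cong (+ d *_) (partialProduct-stable (ℕ.≤⇒≤′ d≤N)) ⟨
    δ (P N) d             ≡⟨ δpartialProduct N d ⟩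
    (P N ⋆ logDeriv N) d  ≡⟨ ⋆-comm (P N) (logDeriv N) d ⟩
    (logDeriv N ⋆ P N) d  ≡⟨ ⋆-cong {logDeriv N} {logDeriv N} {P N} {s} d (λ _ _ → refl)
                               (λ a a≤d → partialProduct-stable (ℕ.≤⇒≤′ (ℕ.≤-trans a≤d d≤N))) ⟩
    (logDeriv N ⋆ s) d    ∎

  logDeriv-suc : ∀ K d → suc d ≤ K → logDeriv K (suc d) ≡ sgn d * divisorSum (signedWeightedDim v) (suc d)
  logDeriv-suc K d d<K = begin
    ∑[ k < K ] factorLogDeriv v k (suc d)
      ≡⟨ ∑-truncate (suc d) K d<K (λ k d<k _ → factorLogDeriv-nondivisible v k (suc d) (>⇒∤ (s≤s d<k))) ⟩
    ∑[ k < suc d ] factorLogDeriv v k (suc d)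
      ≡⟨ ∑-ext (suc d) term ⟩
    ∑[ k < suc d ] (sgn d * when (suc k ∣? suc d) (signedWeightedDim v (suc k)))
      ≡⟨ ∑-*ˡ (suc d) (sgn d) (λ k → when (suc k ∣? suc d) (signedWeightedDim v (suc k))) ⟩
    sgn d * divisorSum (signedWeightedDim v) (suc d) ∎
    where
    term : ∀ k → factorLogDeriv v k (suc d) ≡ sgn d * when (suc k ∣? suc d) (signedWeightedDim v (suc k))
    term k = trans (cong (when (suc k ∣? suc d)) (trans (cong (_* _) signs) (ℤ.*-assoc (sgn d) _ _)))
                   (sym (*-when (sgn d) (suc k ∣? suc d) _))
      where
      signs : sgn (suc d +ᴺ suc k) ≡ sgn d * sgn (suc (suc k))
      signs = trans (cong sgn (sym (ℕ.+-suc d (suc k)))) (sgn-+ d (suc (suc k)))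

  poincareS-newton : ∀ N n → n < N → NewtonIdentity s (divisorSum (signedWeightedDim v)) n
  poincareS-newton N n n<N = begin
    δ s (suc n)
      ≡⟨ δpoincareS N (suc n) n<N ⟩
    logDeriv N 0 * s (suc n) + ∑[ a < suc n ] (logDeriv N (suc a) * s (n ∸ a))
      ≡⟨ cong₂ _+_ (trans (cong (_* s (suc n)) (∑-replicate-zero N)) (ℤ.*-zeroˡ (s (suc n))))
                   (∑-cong (suc n) (λ a a≤n → cong (_* s (n ∸ a)) (logDeriv-suc N a (ℕ.≤-trans a≤n n<N)))) ⟩
    + 0 + ∑[ a < suc n ] (sgn a * divisorSum (signedWeightedDim v) (suc a) * s (n ∸ a))
      ≡⟨ ℤ.+-identityˡ _ ⟩
    ∑[ a < suc n ] (sgn a * divisorSum (signedWeightedDim v) (suc a) * s (n ∸ a)) ∎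

powerSum-poincareS : ∀ v d → 1 ≤ d → powerSum (λ n → + poincareS v n) d ≡ divisorSum (signedWeightedDim v) d
powerSum-poincareS v d 1≤d =
  powerSum-newton (λ n → + poincareS v n) (divisorSum (signedWeightedDim v)) refl d 1≤d (poincareS-newton v d)

mainTheorem2 : (v : ℕ → ℕ) (N : ℕ) → 1 ≤ N →
    (+ N) * (+ v N)
      ≡ sgn (suc N)
        * sumℤ (map (λ j → μ (N / suc j) * powerSum (λ n → + poincareS v n) (suc j))
                    (divisorsPred N))
mainTheorem2 v N 1≤N = begin
  + N * + v N
    ≡⟨ sgn-cancelˡ (suc N) (+ N * + v N) ⟩
  σ * signedWeightedDim v N
    ≡⟨ cong (σ *_) (möbius-inversion (signedWeightedDim v) N 1≤N) ⟨
  σ * ∑[ j < N ] when (suc j ∣? N) (μ (N / suc j) * divisorSum (signedWeightedDim v) (suc j))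
    ≡⟨ cong (σ *_) (∑-ext N (λ j → cong (λ x → when (suc j ∣? N) (μ (N / suc j) * x))
                                        (sym (powerSum-poincareS v (suc j) (s≤s z≤n))))) ⟩
  σ * ∑[ j < N ] when (suc j ∣? N) (term j)
    ≡⟨ cong (σ *_) (sumℤ-divisorsPred N term) ⟨
  σ * sumℤ (map term (divisorsPred N)) ∎
  where
  σ = sgn (suc N)
  term : ℕ → ℤ
  term j = μ (N / suc j) * powerSum (λ n → + poincareS v n) (suc j)
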